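{- Let $G$ be a finite connected undirected multigraph with vertex set $V$, fix $q\in V$, and use the notation $\mathbb{E}_{[D]}$, $\operatorname{ord}_q(v)$ described in the context. (1) (Existence) There exists a finite subset $\mathcal{P}\subset\mathbb{E}_{[0]}$ and, for each $[D]\in\operatorname{Jac}(G)$, a finite subset $\mathcal{S}_{[D]}\subset\mathbb{E}_{[D]}$ such that each $E\in\mathbb{E}_{[D]}$ can be written uniquely as $E=F+\sum_{P\in\mathcal{P}}a_PP$ with $F\in\mathcal{S}_{[D]}$ and $a_P\in\mathbb{N}$ for all $P\in\mathcal{P}$. ($\mathcal{P}$ is called a set of primary divisors and $\mathcal{S}_{[D]}$ the set of $[D]$-secondary divisors with respect to $\mathcal{P}$.) (2) (Uniqueness) Sets $\mathcal{P}$ and $\{\mathcal{S}_{[D]}\}_{[D]\in\operatorname{Jac}(G)}$ satisfy part (1) if and only if \[\mathcal{P}=\{\ell_v v: v\in V\}\quad\text{and}\quad \mathcal{S}_{[D]}=\{E\in\mathbb{E}_{[D]}: E(v)<\ell_v\text{ for all }v\in V\}\ \text{for every }[D]\in\operatorname{Jac}(G),\] where, for each $v\in V$, $\ell_v$ is a positive integer multiple of $\operatorname{ord}_q(v)$. In particular, taking $\ell_v=\operatorname{ord}_q(v)$ for all $v$ produces the set of primary divisors of smallest degree and corresponding sets of secondary divisors of minimal cardinality.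
   Context: $G$ is a finite connected undirected multigraph (loops allowed) with vertex set $V$. A divisor is an element $D=\sum_{v\in V}D(v)v$ of the free abelian group $\mathrm{Div}(G)=\mathbb{Z}V$; its degree is $\deg(D)=\sum_v D(v)$. The Laplacian $L:\mathbb{Z}^V\to\mathbb{Z}^V$ is $(Lf)(v)=\sum_{\text{edges }vw}(f(v)-f(w))$; the divisor of $f$ is $\sum_v (Lf)(v)\,v$, and such divisors are called principal. Two divisors are linearly equivalent, $D\sim D'$, if $D-D'$ is principal. $\operatorname{Jac}(G)$ is the group of degree-$0$ divisors modulo principal divisors, and $[D]$ denotes the class of $D$. A divisor $E$ is effective ($E\ge 0$) if $E(v)\ge0$ for all $v$. The complete linear system of $D$ is $|D|=\{E\in\mathrm{Div}(G):E\ge0,\ E\sim D\}$. Fix $q\in V$. For $[D]\in\operatorname{Jac}(G)$, $\mathbb{E}_{[D]}=\bigcup_{k\ge0}|D+kq|=\{E\ge0: E-\deg(E)q\sim D\}$. For $v\in V$, $\operatorname{ord}_q(v)$ is the order of $[v-q]$ in $\operatorname{Jac}(G)$ (so $\operatorname{ord}_q(q)=1$). $\mathbb{N}=\mathbb{Z}_{\ge0}$. -}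

module Defs where

open import Data.Nat as ℕ using (ℕ; zero; suc)
open import Data.Integer as ℤ using (ℤ; +_; 0ℤ; 1ℤ)
open import Data.Fin using (Fin; zero; suc; _≟_)
open import Data.Vec using (Vec; []; _∷_; tabulate; lookup; replicate; zipWith)
open import Data.List using (List; []; _∷_; length)
open import Data.List.Membership.Propositional using (_∈_)
open import Data.List.Relation.Unary.Unique.Propositional using (Unique)
open import Data.Product using (Σ; ∃; _×_; _,_)
open import Data.Bool using (if_then_else_)
open import Relation.Nullary using (¬_; does)
open import Relation.Binary.PropositionalEquality using (_≡_)

-- Finite connected undirected multigraphs on the vertex set Fin n.
-- adj u v = number of edges between u and v (adj v v = number of loops).

record Multigraph (n : ℕ) : Set where
  field
    adj : Fin n → Fin n → ℕ
    sym : ∀ u v → adj u v ≡ adj v u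

open Multigraph public

data Reach {n : ℕ} (G : Multigraph n) : Fin n → Fin n → Set where
  here : ∀ {v} → Reach G v v
  step : ∀ {u w v} → 0 ℕ.< adj G u w → Reach G w v → Reach G u v

Connected : ∀ {n} → Multigraph n → Set
Connected G = ∀ u v → Reach G u v

sumFin : ∀ {n} → (Fin n → ℤ) → ℤ
sumFin {zero}  f = 0ℤ
sumFin {suc n} f = f zero ℤ.+ sumFin (λ i → f (suc i))

Div : ℕ → Set
Div n = Vec ℤ n

deg : ∀ {n} → Div n → ℤ
deg D = sumFin (lookup D)

_⊕_ : ∀ {n} → Div n → Div n → Div n
_⊕_ = zipWith ℤ._+_

_⊖_ : ∀ {n} → Div n → Div n → Div n
_⊖_ = zipWith ℤ._-_

_·_ : ∀ {n} → ℤ → Div n → Div n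
k · D = tabulate (λ v → k ℤ.* lookup D v)

zeroDiv : ∀ {n} → Div n
zeroDiv = replicate _ 0ℤ

unit : ∀ {n} → Fin n → Div n
unit v = tabulate (λ w → if does (v ≟ w) then 1ℤ else 0ℤ)

Effective : ∀ {n} → Div n → Set
Effective D = ∀ v → 0ℤ ℤ.≤ lookup D v

laplacian : ∀ {n} → Multigraph n → (Fin n → ℤ) → Div n
laplacian G f = tabulate (λ v → sumFin (λ w → (+ adj G v w) ℤ.* (f v ℤ.- f w)))

Principal : ∀ {n} → Multigraph n → Div n → Set
Principal G D = ∃ λ (f : _ → ℤ) → D ≡ laplacian G f

_∼⟨_⟩_ : ∀ {n} → Div n → Multigraph n → Div n → Set
D ∼⟨ G ⟩ D' = Principal G (D ⊖ D')

InE : ∀ {n} → Multigraph n → Fin n → Div n → Div n → Set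
InE G q D E = Effective E × ((E ⊖ (deg E · unit q)) ∼⟨ G ⟩ D)

IsOrd : ∀ {n} → Multigraph n → Fin n → Fin n → ℕ → Set
IsOrd G q v o =
  0 ℕ.< o × Principal G ((+ o) · (unit v ⊖ unit q))
  × (∀ m → 0 ℕ.< m → m ℕ.< o → ¬ Principal G ((+ m) · (unit v ⊖ unit q)))

PosMultOfOrd : ∀ {n} → Multigraph n → Fin n → Fin n → ℕ → Set
PosMultOfOrd G q v ℓ = ∃ λ o → IsOrd G q v o × ∃ λ m → 0 ℕ.< m × ℓ ≡ m ℕ.* o

-- Finite sets of divisors are represented by lists; the set 𝒫 of
-- primary divisors by a duplicate-free list, so that coefficient
-- families (a_P)_{P ∈ 𝒫} are functions on positions Fin (length 𝒫).

comb : ∀ {n} (𝒫 : List (Div n)) → (Fin (length 𝒫) → ℕ) → Div n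
comb []      a = zeroDiv
comb (X ∷ 𝒫) a = ((+ a zero) · X) ⊕ comb 𝒫 (λ i → a (suc i))

-- The sets 𝒫 and (𝒮_[D])_{[D] ∈ Jac(G)} satisfy part (1).
-- The family 𝒮 is given on degree-0 representatives D and is required
-- to depend only on the class [D].
Part1 : ∀ {n} → Multigraph n → Fin n → List (Div n) → (Div n → List (Div n)) → Set
Part1 {n} G q 𝒫 𝒮 =
  Unique 𝒫
  × (∀ X → X ∈ 𝒫 → InE G q zeroDiv X)
  × (∀ D → deg D ≡ 0ℤ → ∀ F → F ∈ 𝒮 D → InE G q D F)
  × (∀ D D' → deg D ≡ 0ℤ → deg D' ≡ 0ℤ → D ∼⟨ G ⟩ D' →
       ∀ X → (X ∈ 𝒮 D → X ∈ 𝒮 D') × (X ∈ 𝒮 D' → X ∈ 𝒮 D))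
  × (∀ D → deg D ≡ 0ℤ → ∀ E → InE G q D E →
       (Σ (Div n) λ F → Σ (Fin (length 𝒫) → ℕ) λ a →
          F ∈ 𝒮 D × E ≡ F ⊕ comb 𝒫 a)
     × (∀ F F' a a' → F ∈ 𝒮 D → F' ∈ 𝒮 D →
          E ≡ F ⊕ comb 𝒫 a → E ≡ F' ⊕ comb 𝒫 a' →
          F ≡ F' × (∀ i → a i ≡ a' i)))

Characterized : ∀ {n} → Multigraph n → Fin n → List (Div n) → (Div n → List (Div n)) → Set
Characterized {n} G q 𝒫 𝒮 =
  Σ (Fin n → ℕ) λ ℓ →
    (∀ v → PosMultOfOrd G q v (ℓ v))
    × (∀ X → (X ∈ 𝒫 → ∃ λ v → X ≡ (+ ℓ v) · unit v)
           × ((∃ λ v → X ≡ (+ ℓ v) · unit v) → X ∈ 𝒫))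
    × (∀ D → deg D ≡ 0ℤ → ∀ E →
         (E ∈ 𝒮 D → InE G q D E × (∀ v → lookup E v ℤ.< + ℓ v))
         × (InE G q D E × (∀ v → lookup E v ℤ.< + ℓ v) → E ∈ 𝒮 D))

-- If 𝒫 = {ℓ_v v} with ord_q(v) ∣ ℓ_v, decomposing E ∈ 𝔼_[D] is division with
-- remainder at every vertex, E(v) = F(v) + a_v ℓ_v with 0 ≤ F(v) < ℓ_v, and F ∈ 𝔼_[D] because
-- ℓ_v v ∈ 𝔼_[0]. Conversely, if 𝒫 and 𝒮 satisfy part (1), decomposing K ord_q(v) v with K larger
-- than every entry of a [0]-secondary divisor exhibits a primary divisor c_v v with ord_q(v) ∣ c_v;
-- with M = ∏ c_v, the two decompositions of M P for a primary P (one through P, one through the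
-- c_v v) must agree, so every primary is one of the c_v v, and 𝒮 is forced to consist of the
-- remainders. Part (1) is then the case ℓ_v = ord_q(v), which needs ord_q(v) to exist and 𝔼 to be
-- decidable: firing vertices other than q raises a geometrically weighted energy that is
-- bounded above, so every k (v - q) is equivalent to one of finitely many stable divisors; and a
-- potential f with L f = D, normalised by f(q) = 0, is bounded in terms of D.

module Submission where

open import Defs hiding (sym)
open import Data.Nat as ℕ using (ℕ; zero; suc; _∸_; _^_; z≤n; s≤s)
import Data.Nat.Properties as ℕP
import Data.Nat.DivMod as ℕD
open import Data.Nat.Divisibility using (_∣_; m∣m*n; ∣n⇒∣m*n)
open import Data.Integer as ℤ
  using (ℤ; +_; -[1+_]; 0ℤ; 1ℤ; _+_; _*_; _-_; -_; _≤_; _<_; +≤+; +<+; -≤+; ∣_∣)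
import Data.Integer.Properties as ℤP
open import Data.Integer.Tactic.RingSolver using (solve-∀)
open import Data.Fin as F using (Fin; zero; suc; _≟_; toℕ)
import Data.Fin.Properties as FP
open import Data.Vec using (Vec; []; _∷_; tabulate; lookup)
import Data.Vec.Properties as VP
open import Data.List as L using (List; []; _∷_; length; upTo; _++_)
open import Data.List.Membership.Propositional using (_∈_; lose)
open import Data.List.Membership.Propositional.Properties
open import Data.List.Relation.Unary.Any as Any using (here; there; any?)
import Data.List.Relation.Unary.Any.Properties as AnyP
import Data.List.Relation.Unary.All as All
open import Data.List.Relation.Unary.AllPairs using (_∷_)
open import Data.List.Relation.Unary.Unique.Propositional using (Unique)
import Data.List.Relation.Unary.Unique.Propositional.Properties as UniqueP
open import Data.Product using (Σ; ∃; _×_; _,_; proj₁; proj₂)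
open import Data.Sum using (_⊎_; inj₁; inj₂; [_,_]′)
open import Data.Empty using (⊥-elim)
open import Data.Bool using (if_then_else_)
open import Relation.Nullary using (¬_; Dec; yes; no; does; ¬?)
open import Relation.Nullary.Decidable using (_×-dec_; _⊎-dec_)
open import Relation.Binary.PropositionalEquality
open import Function using (_∘_)

0≤+ : ∀ k → 0ℤ ≤ + k
0≤+ k = +≤+ z≤n

0≤+* : ∀ k {b} → 0ℤ ≤ b → 0ℤ ≤ + k * b
0≤+* k {+ m} _ = subst (0ℤ ≤_) (ℤP.pos-* k m) (0≤+ _)

nonNeg-sum≡0ˡ : ∀ {x y} → x + y ≡ 0ℤ → 0ℤ ≤ x → 0ℤ ≤ y → x ≡ 0ℤ
nonNeg-sum≡0ˡ {x} {y} e 0≤x 0≤y = ℤP.≤-antisym (subst (x ≤_) e (ℤP.i≤i+j x y {{ℤ.nonNegative 0≤y}})) 0≤x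

i≤∣i∣ : ∀ i → i ≤ + ∣ i ∣
i≤∣i∣ (+ n)    = ℤP.≤-refl
i≤∣i∣ -[1+ n ] = -≤+

m-n≡∸ : ∀ {m n} → n ℕ.≤ m → + m - + n ≡ + (m ∸ n)
m-n≡∸ {m} {n} n≤m = trans (ℤP.m-n≡m⊖n m n) (ℤP.⊖-≥ n≤m)

sumFin-cong : ∀ {n} {f g : Fin n → ℤ} → (∀ i → f i ≡ g i) → sumFin f ≡ sumFin g
sumFin-cong {zero}  p = refl
sumFin-cong {suc n} p = cong₂ _+_ (p zero) (sumFin-cong (λ i → p (suc i)))

sumFin-0 : ∀ {n} → sumFin {n} (λ _ → 0ℤ) ≡ 0ℤ
sumFin-0 {zero}  = refl
sumFin-0 {suc n} = trans (ℤP.+-identityˡ _) (sumFin-0 {n})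

sumFin-+ : ∀ {n} (f g : Fin n → ℤ) → sumFin (λ i → f i + g i) ≡ sumFin f + sumFin g
sumFin-+ {zero}  f g = refl
sumFin-+ {suc n} f g rewrite sumFin-+ (λ i → f (suc i)) (λ i → g (suc i)) =
  interchange (f zero) (g zero) (sumFin (λ i → f (suc i))) (sumFin (λ i → g (suc i)))
  where
  interchange : ∀ a b c d → a + b + (c + d) ≡ a + c + (b + d)
  interchange = solve-∀

sumFin-*ˡ : ∀ {n} (k : ℤ) (f : Fin n → ℤ) → sumFin (λ i → k * f i) ≡ k * sumFin f
sumFin-*ˡ {zero}  k f = sym (ℤP.*-zeroʳ k)
sumFin-*ˡ {suc n} k f rewrite sumFin-*ˡ k (λ i → f (suc i)) = sym (ℤP.*-distribˡ-+ k (f zero) _)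

sumFin-neg : ∀ {n} (f : Fin n → ℤ) → sumFin (λ i → - f i) ≡ - sumFin f
sumFin-neg f = begin
  sumFin (λ i → - f i)       ≡⟨ sumFin-cong (λ i → sym (ℤP.-1*i≡-i (f i))) ⟩
  sumFin (λ i → - 1ℤ * f i)  ≡⟨ sumFin-*ˡ (- 1ℤ) f ⟩
  - 1ℤ * sumFin f            ≡⟨ ℤP.-1*i≡-i _ ⟩
  - sumFin f                 ∎
  where open ≡-Reasoning

sumFin-- : ∀ {n} (f g : Fin n → ℤ) → sumFin (λ i → f i - g i) ≡ sumFin f - sumFin g
sumFin-- f g = trans (sumFin-+ f (λ i → - g i)) (cong (λ z → sumFin f + z) (sumFin-neg g))

sumFin-swap : ∀ {n m} (g : Fin n → Fin m → ℤ) →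
  sumFin (λ i → sumFin (g i)) ≡ sumFin (λ j → sumFin (λ i → g i j))
sumFin-swap {zero}  {m} g = sym (sumFin-0 {m})
sumFin-swap {suc n} {m} g =
  trans (cong (λ z → sumFin (g zero) + z) (sumFin-swap (λ i → g (suc i))))
        (sym (sumFin-+ (g zero) (λ j → sumFin (λ i → g (suc i) j))))

sumFin-single : ∀ {n} (f : Fin n → ℤ) (j : Fin n) → (∀ i → i ≢ j → f i ≡ 0ℤ) → sumFin f ≡ f j
sumFin-single {suc n} f zero h =
  trans (cong (λ z → f zero + z) (trans (sumFin-cong (λ i → h (suc i) (λ ()))) (sumFin-0 {n})))
        (ℤP.+-identityʳ _)
sumFin-single {suc n} f (suc j) h =
  trans (cong (_+ sumFin (λ i → f (suc i))) (h zero (λ ())))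
   (trans (ℤP.+-identityˡ _)
    (sumFin-single (λ i → f (suc i)) j (λ i i≢j → h (suc i) (λ e → i≢j (FP.suc-injective e)))))

sumFin-mono : ∀ {n} {f g : Fin n → ℤ} → (∀ i → f i ≤ g i) → sumFin f ≤ sumFin g
sumFin-mono {zero}  p = ℤP.≤-refl
sumFin-mono {suc n} p = ℤP.+-mono-≤ (p zero) (sumFin-mono (λ i → p (suc i)))

sumFin-nonNeg : ∀ {n} {f : Fin n → ℤ} → (∀ i → 0ℤ ≤ f i) → 0ℤ ≤ sumFin f
sumFin-nonNeg {n} {f} p = subst (_≤ sumFin f) (sumFin-0 {n}) (sumFin-mono p)

sumFin-nonPos : ∀ {n} {f : Fin n → ℤ} → (∀ i → f i ≤ 0ℤ) → sumFin f ≤ 0ℤ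
sumFin-nonPos {n} {f} p = subst (sumFin f ≤_) (sumFin-0 {n}) (sumFin-mono p)

term≤sumFin : ∀ {n} (f : Fin n → ℤ) → (∀ i → 0ℤ ≤ f i) → ∀ j → f j ≤ sumFin f
term≤sumFin {suc n} f p zero    = ℤP.i≤i+j (f zero) _ {{ℤ.nonNegative (sumFin-nonNeg (λ i → p (suc i)))}}
term≤sumFin {suc n} f p (suc j) =
  ℤP.≤-trans (term≤sumFin (λ i → f (suc i)) (λ i → p (suc i)) j) (ℤP.i≤j+i _ (f zero) {{ℤ.nonNegative (p zero)}})

sumFin-pos⇒term-pos : ∀ {n} (f : Fin n → ℤ) → 0ℤ < sumFin f → ∃ λ i → 0ℤ < f i
sumFin-pos⇒term-pos {zero}  f (+<+ ())
sumFin-pos⇒term-pos {suc n} f 0<Σ with 0ℤ ℤ.<? f zero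
... | yes 0<f₀ = zero , 0<f₀
... | no  0≮f₀ with sumFin-pos⇒term-pos (λ i → f (suc i))
                      (ℤP.≰⇒> λ Σ≤0 → ℤP.<⇒≱ 0<Σ (ℤP.+-mono-≤ (ℤP.≮⇒≥ 0≮f₀) Σ≤0))
...   | i , 0<fᵢ = suc i , 0<fᵢ

nonNeg-sumFin≤0⇒0 : ∀ {n} (f : Fin n → ℤ) → (∀ i → 0ℤ ≤ f i) → sumFin f ≤ 0ℤ → ∀ i → f i ≡ 0ℤ
nonNeg-sumFin≤0⇒0 f p Σ≤0 i = ℤP.≤-antisym (ℤP.≤-trans (term≤sumFin f p i) Σ≤0) (p i)

sumFin-antisym≡0 : ∀ {n} (g : Fin n → Fin n → ℤ) → (∀ i j → g j i ≡ - g i j) →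
  sumFin (λ i → sumFin (g i)) ≡ 0ℤ
sumFin-antisym≡0 g anti = x≡-x⇒x≡0 _ (begin
  sumFin (λ i → sumFin (g i))                 ≡⟨ sumFin-swap g ⟩
  sumFin (λ j → sumFin (λ i → g i j))         ≡⟨ sumFin-cong (λ j → sumFin-cong (λ i → anti j i)) ⟩
  sumFin (λ j → sumFin (λ i → - g j i))       ≡⟨ sumFin-cong (λ j → sumFin-neg (g j)) ⟩
  sumFin (λ j → - sumFin (g j))               ≡⟨ sumFin-neg (λ j → sumFin (g j)) ⟩
  - sumFin (λ i → sumFin (g i))               ∎)
  where
  open ≡-Reasoning
  x≡-x⇒x≡0 : ∀ x → x ≡ - x → x ≡ 0ℤ
  x≡-x⇒x≡0 (+ zero)  _ = refl
  x≡-x⇒x≡0 (+ suc n) ()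
  x≡-x⇒x≡0 -[1+ n ]  ()

sumℕ : ∀ {n} → (Fin n → ℕ) → ℕ
sumℕ {zero}  f = 0
sumℕ {suc n} f = f zero ℕ.+ sumℕ (λ i → f (suc i))

term≤sumℕ : ∀ {n} (f : Fin n → ℕ) j → f j ℕ.≤ sumℕ f
term≤sumℕ f zero    = ℕP.m≤m+n _ _
term≤sumℕ f (suc j) = ℕP.≤-trans (term≤sumℕ (λ i → f (suc i)) j) (ℕP.m≤n+m _ (f zero))

sumFin-fromℕ : ∀ {n} (f : Fin n → ℕ) → sumFin (λ i → + f i) ≡ + sumℕ f
sumFin-fromℕ {zero}  f = refl
sumFin-fromℕ {suc n} f = cong (λ z → + f zero + z) (sumFin-fromℕ (λ i → f (suc i)))

Div-ext : ∀ {n} {D E : Div n} → (∀ v → lookup D v ≡ lookup E v) → D ≡ E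
Div-ext {D = D} {E} p =
  trans (sym (VP.tabulate∘lookup D)) (trans (VP.tabulate-cong p) (VP.tabulate∘lookup E))

lookup-⊕ : ∀ {n} (D E : Div n) v → lookup (D ⊕ E) v ≡ lookup D v + lookup E v
lookup-⊕ D E v = VP.lookup-zipWith _ v D E

lookup-⊖ : ∀ {n} (D E : Div n) v → lookup (D ⊖ E) v ≡ lookup D v - lookup E v
lookup-⊖ D E v = VP.lookup-zipWith _ v D E

lookup-· : ∀ {n} k (D : Div n) v → lookup (k · D) v ≡ k * lookup D v
lookup-· k D v = VP.lookup∘tabulate _ v

lookup-zeroDiv : ∀ {n} (v : Fin n) → lookup zeroDiv v ≡ 0ℤ
lookup-zeroDiv v = VP.lookup-replicate v 0ℤ

lookup-unit-same : ∀ {n} (v : Fin n) → lookup (unit v) v ≡ 1ℤ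
lookup-unit-same v rewrite VP.lookup∘tabulate (λ w → if does (v ≟ w) then 1ℤ else 0ℤ) v
  with v ≟ v
... | yes _  = refl
... | no v≢v = ⊥-elim (v≢v refl)

lookup-unit-other : ∀ {n} {v w : Fin n} → v ≢ w → lookup (unit v) w ≡ 0ℤ
lookup-unit-other {v = v} {w} v≢w rewrite VP.lookup∘tabulate (λ u → if does (v ≟ u) then 1ℤ else 0ℤ) w
  with v ≟ w
... | yes v≡w = ⊥-elim (v≢w v≡w)
... | no _    = refl

unit-nonNeg : ∀ {n} (v w : Fin n) → 0ℤ ≤ lookup (unit v) w
unit-nonNeg v w with v ≟ w
... | yes refl = subst (0ℤ ≤_) (sym (lookup-unit-same v)) (0≤+ 1)
... | no v≢w   = subst (0ℤ ≤_) (sym (lookup-unit-other v≢w)) (0≤+ 0)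

lookup-·unit-same : ∀ {n} k (v : Fin n) → lookup (k · unit v) v ≡ k
lookup-·unit-same k v =
  trans (lookup-· k (unit v) v) (trans (cong (k *_) (lookup-unit-same v)) (ℤP.*-identityʳ k))

lookup-·unit-other : ∀ {n} k {v w : Fin n} → v ≢ w → lookup (k · unit v) w ≡ 0ℤ
lookup-·unit-other k {v} {w} v≢w =
  trans (lookup-· k (unit v) w) (trans (cong (k *_) (lookup-unit-other v≢w)) (ℤP.*-zeroʳ k))

·unit-injective : ∀ {n} a b (v w : Fin n) → 0 ℕ.< a → (+ a) · unit v ≡ (+ b) · unit w → v ≡ w
·unit-injective a b v w 0<a e with v ≟ w
... | yes v≡w = v≡w
... | no  v≢w = ⊥-elim (ℕP.<⇒≢ 0<a (sym (ℤP.+-injective (begin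
  + a                        ≡⟨ sym (lookup-·unit-same (+ a) v) ⟩
  lookup ((+ a) · unit v) v  ≡⟨ cong (λ D → lookup D v) e ⟩
  lookup ((+ b) · unit w) v  ≡⟨ lookup-·unit-other (+ b) (λ w≡v → v≢w (sym w≡v)) ⟩
  0ℤ                         ∎))))
  where open ≡-Reasoning

·unit-effective : ∀ {n} c (v : Fin n) → Effective ((+ c) · unit v)
·unit-effective c v w = subst (0ℤ ≤_) (sym (lookup-· (+ c) (unit v) w)) (0≤+* c (unit-nonNeg v w))

deg-lincomb : ∀ {n} (D E X : Div n) a b → (∀ v → lookup X v ≡ a * lookup D v + b * lookup E v) →
  deg X ≡ a * deg D + b * deg E
deg-lincomb D E X a b h =
  trans (sumFin-cong h)
   (trans (sumFin-+ (λ v → a * lookup D v) (λ v → b * lookup E v))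
          (cong₂ _+_ (sumFin-*ˡ a (lookup D)) (sumFin-*ˡ b (lookup E))))

deg-⊖ : ∀ {n} (D E : Div n) → deg (D ⊖ E) ≡ deg D - deg E
deg-⊖ D E = trans (sumFin-cong (lookup-⊖ D E)) (sumFin-- (lookup D) (lookup E))

deg-· : ∀ {n} k (D : Div n) → deg (k · D) ≡ k * deg D
deg-· k D = trans (sumFin-cong (lookup-· k D)) (sumFin-*ˡ k (lookup D))

deg-zeroDiv : ∀ {n} → deg (zeroDiv {n}) ≡ 0ℤ
deg-zeroDiv {n} = trans (sumFin-cong {n} lookup-zeroDiv) (sumFin-0 {n})

deg-unit : ∀ {n} (v : Fin n) → deg (unit v) ≡ 1ℤ
deg-unit v =
  trans (sumFin-single _ v (λ w w≢v → lookup-unit-other (λ v≡w → w≢v (sym v≡w)))) (lookup-unit-same v)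

deg-unit-difference : ∀ {n} k (v q : Fin n) → deg (k · (unit v ⊖ unit q)) ≡ 0ℤ
deg-unit-difference k v q = begin
  deg (k · (unit v ⊖ unit q))    ≡⟨ deg-· k (unit v ⊖ unit q) ⟩
  k * deg (unit v ⊖ unit q)      ≡⟨ cong (k *_) (deg-⊖ (unit v) (unit q)) ⟩
  k * (deg (unit v) - deg (unit q)) ≡⟨ cong (k *_) (cong₂ _-_ (deg-unit v) (deg-unit q)) ⟩
  k * 0ℤ                         ≡⟨ ℤP.*-zeroʳ k ⟩
  0ℤ                             ∎
  where open ≡-Reasoning

flow : ∀ {n} → Multigraph n → (Fin n → ℤ) → Fin n → Fin n → ℤ
flow G f v w = (+ adj G v w) * (f v - f w)

lookup-laplacian : ∀ {n} (G : Multigraph n) f v → lookup (laplacian G f) v ≡ sumFin (flow G f v)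
lookup-laplacian G f v = VP.lookup∘tabulate _ v

flow-antisym : ∀ {n} (G : Multigraph n) f v w → flow G f w v ≡ - flow G f v w
flow-antisym G f v w rewrite Multigraph.sym G w v = antisym (+ adj G v w) (f v) (f w)
  where
  antisym : ∀ c x y → c * (y - x) ≡ - (c * (x - y))
  antisym = solve-∀

deg-laplacian : ∀ {n} (G : Multigraph n) f → deg (laplacian G f) ≡ 0ℤ
deg-laplacian G f =
  trans (sumFin-cong (lookup-laplacian G f)) (sumFin-antisym≡0 (flow G f) (flow-antisym G f))

principal-lincomb : ∀ {n} (G : Multigraph n) {D E : Div n} → Principal G D → Principal G E →
  ∀ a b (X : Div n) → (∀ v → lookup X v ≡ a * lookup D v + b * lookup E v) → Principal G X
principal-lincomb G {D} {E} (f , D≡Lf) (g , E≡Lg) a b X h = fg , Div-ext λ v → begin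
  lookup X v                                          ≡⟨ h v ⟩
  a * lookup D v + b * lookup E v                     ≡⟨ cong₂ (λ x y → a * x + b * y)
                                                           (trans (cong (λ Y → lookup Y v) D≡Lf) (lookup-laplacian G f v))
                                                           (trans (cong (λ Y → lookup Y v) E≡Lg) (lookup-laplacian G g v)) ⟩
  a * sumFin (flow G f v) + b * sumFin (flow G g v)   ≡⟨ sym (cong₂ _+_ (sumFin-*ˡ a (flow G f v)) (sumFin-*ˡ b (flow G g v))) ⟩
  sumFin (λ w → a * flow G f v w) + sumFin (λ w → b * flow G g v w)
                                                      ≡⟨ sym (sumFin-+ (λ w → a * flow G f v w) (λ w → b * flow G g v w)) ⟩
  sumFin (λ w → a * flow G f v w + b * flow G g v w)  ≡⟨ sumFin-cong (λ w → flow-lincomb a b (+ adj G v w) (f v) (f w) (g v) (g w)) ⟩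
  sumFin (flow G fg v)                                ≡⟨ sym (lookup-laplacian G fg v) ⟩
  lookup (laplacian G fg) v                           ∎
  where
  open ≡-Reasoning
  fg : _ → ℤ
  fg u = a * f u + b * g u
  flow-lincomb : ∀ a b c x y z t → a * (c * (x - y)) + b * (c * (z - t)) ≡ c * ((a * x + b * z) - (a * y + b * t))
  flow-lincomb = solve-∀

principal-zeroDiv : ∀ {n} (G : Multigraph n) → Principal G zeroDiv
principal-zeroDiv {n} G = (λ _ → 0ℤ) , Div-ext λ v →
  trans (lookup-zeroDiv v)
   (sym (trans (lookup-laplacian G (λ _ → 0ℤ) v)
               (trans (sumFin-cong (λ w → ℤP.*-zeroʳ (+ adj G v w))) (sumFin-0 {n}))))

principal-scale : ∀ {n} (G : Multigraph n) {D : Div n} → Principal G D → ∀ a (X : Div n) →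
  (∀ v → lookup X v ≡ a * lookup D v) → Principal G X
principal-scale G {D} pD a X h = principal-lincomb G pD (principal-zeroDiv G) a 0ℤ X λ v →
  trans (h v) (sym (trans (cong (λ z → a * lookup D v + z) (ℤP.*-zeroˡ (lookup zeroDiv v))) (ℤP.+-identityʳ _)))

principal-pointwise : ∀ {n} (G : Multigraph n) {D : Div n} → Principal G D → (X : Div n) →
  (∀ v → lookup X v ≡ lookup D v) → Principal G X
principal-pointwise G pD X h = principal-scale G pD 1ℤ X (λ v → trans (h v) (sym (ℤP.*-identityˡ _)))

principal-+ : ∀ {n} (G : Multigraph n) {D E : Div n} → Principal G D → Principal G E → (X : Div n) →
  (∀ v → lookup X v ≡ lookup D v + lookup E v) → Principal G X
principal-+ G {D} {E} pD pE X h = principal-lincomb G pD pE 1ℤ 1ℤ X λ v →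
  trans (h v) (sym (cong₂ _+_ (ℤP.*-identityˡ (lookup D v)) (ℤP.*-identityˡ (lookup E v))))

∼-refl : ∀ {n} (G : Multigraph n) (D : Div n) → D ∼⟨ G ⟩ D
∼-refl G D = principal-pointwise G (principal-zeroDiv G) (D ⊖ D) λ u →
  trans (lookup-⊖ D D u) (trans (ℤP.+-inverseʳ (lookup D u)) (sym (lookup-zeroDiv u)))

∼-sym : ∀ {n} (G : Multigraph n) {D E : Div n} → D ∼⟨ G ⟩ E → E ∼⟨ G ⟩ D
∼-sym G {D} {E} D∼E = principal-scale G D∼E (- 1ℤ) (E ⊖ D) λ u → begin
  lookup (E ⊖ D) u              ≡⟨ lookup-⊖ E D u ⟩
  lookup E u - lookup D u       ≡⟨ negate (lookup E u) (lookup D u) ⟩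
  - 1ℤ * (lookup D u - lookup E u) ≡⟨ cong (- 1ℤ *_) (sym (lookup-⊖ D E u)) ⟩
  - 1ℤ * lookup (D ⊖ E) u       ∎
  where
  open ≡-Reasoning
  negate : ∀ a b → a - b ≡ - 1ℤ * (b - a)
  negate = solve-∀

∼-trans : ∀ {n} (G : Multigraph n) {D E F : Div n} → D ∼⟨ G ⟩ E → E ∼⟨ G ⟩ F → D ∼⟨ G ⟩ F
∼-trans G {D} {E} {F} D∼E E∼F = principal-+ G D∼E E∼F (D ⊖ F) λ u →
  trans (lookup-⊖ D F u)
   (trans (telescope (lookup D u) (lookup E u) (lookup F u))
          (sym (cong₂ _+_ (lookup-⊖ D E u) (lookup-⊖ E F u))))
  where
  telescope : ∀ a b c → a - c ≡ (a - b) + (b - c)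
  telescope = solve-∀

-- Deciding principality

vecsOver : ∀ {n} → (Fin n → List ℤ) → List (Vec ℤ n)
vecsOver {zero}  R = [] ∷ []
vecsOver {suc n} R = L.cartesianProductWith _∷_ (R zero) (vecsOver (λ i → R (suc i)))

∈-vecsOver : ∀ {n} (R : Fin n → List ℤ) (x : Vec ℤ n) → (∀ i → lookup x i ∈ R i) → x ∈ vecsOver R
∈-vecsOver {zero}  R []      h = here refl
∈-vecsOver {suc n} R (a ∷ x) h =
  ∈-cartesianProductWith⁺ _∷_ (h zero) (∈-vecsOver (λ i → R (suc i)) x (λ i → h (suc i)))

interval : ℕ → List ℤ
interval B = L.map +_ (upTo (suc B)) ++ L.map (λ k → - (+ k)) (upTo (suc B))

∈-interval : ∀ B x → x ≤ + B → - x ≤ + B → x ∈ interval B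
∈-interval B (+ k)    (+≤+ k≤B) _ = ∈-++⁺ˡ (∈-map⁺ +_ (∈-upTo⁺ (s≤s k≤B)))
∈-interval B -[1+ k ] _ (+≤+ k≤B) =
  ∈-++⁺ʳ (L.map +_ (upTo (suc B))) (∈-map⁺ (λ k → - (+ k)) (∈-upTo⁺ (s≤s k≤B)))

l1norm : ∀ {n} → Div n → ℤ
l1norm D = sumFin (λ u → + ∣ lookup D u ∣)

laplacian-pairing : ∀ {n} (G : Multigraph n) (f χ : Fin n → ℤ) →
  sumFin (λ u → sumFin (λ x → (χ u - χ x) * flow G f u x))
    ≡ sumFin (λ u → χ u * lookup (laplacian G f) u) + sumFin (λ u → χ u * lookup (laplacian G f) u)
laplacian-pairing G f χ = begin
  sumFin (λ u → sumFin (λ x → (χ u - χ x) * flow G f u x))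
    ≡⟨ sumFin-cong (λ u → sumFin-cong (λ x →
         trans (split (χ u) (χ x) (flow G f u x)) (cong (λ z → g u x + χ x * z) (sym (flow-antisym G f u x))))) ⟩
  sumFin (λ u → sumFin (λ x → g u x + g x u))
    ≡⟨ sumFin-cong (λ u → sumFin-+ (g u) (λ x → g x u)) ⟩
  sumFin (λ u → sumFin (g u) + sumFin (λ x → g x u))
    ≡⟨ sumFin-+ (λ u → sumFin (g u)) (λ u → sumFin (λ x → g x u)) ⟩
  sumFin (λ u → sumFin (g u)) + sumFin (λ u → sumFin (λ x → g x u))
    ≡⟨ cong (λ z → sumFin (λ u → sumFin (g u)) + z) (sumFin-swap (λ u x → g x u)) ⟩
  sumFin (λ u → sumFin (g u)) + sumFin (λ u → sumFin (g u))
    ≡⟨ cong₂ _+_ pair pair ⟩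
  T + T ∎
  where
  open ≡-Reasoning
  g : _ → _ → ℤ
  g u x = χ u * flow G f u x
  T = sumFin (λ u → χ u * lookup (laplacian G f) u)
  split : ∀ a b l → (a - b) * l ≡ a * l + b * (- l)
  split = solve-∀
  pair : sumFin (λ u → sumFin (g u)) ≡ T
  pair = sumFin-cong (λ u →
    trans (sumFin-*ˡ (χ u) (flow G f u)) (cong (χ u *_) (sym (lookup-laplacian G f u))))

laplacian-selfAdjoint : ∀ {n} (G : Multigraph n) (a b : Fin n → ℤ) →
  sumFin (λ u → a u * lookup (laplacian G b) u) ≡ sumFin (λ u → b u * lookup (laplacian G a) u)
laplacian-selfAdjoint G a b = ℤP.*-cancelˡ-≡ (+ 2) _ _ (begin
  + 2 * X                                                        ≡⟨ double X ⟩
  X + X                                                          ≡⟨ sym (laplacian-pairing G b a) ⟩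
  sumFin (λ u → sumFin (λ x → (a u - a x) * flow G b u x))      ≡⟨ sumFin-cong (λ u → sumFin-cong (λ x →
                                                                      swap (a u) (a x) (b u) (b x) (+ adj G u x))) ⟩
  sumFin (λ u → sumFin (λ x → (b u - b x) * flow G a u x))      ≡⟨ laplacian-pairing G a b ⟩
  Y + Y                                                          ≡⟨ sym (double Y) ⟩
  + 2 * Y                                                        ∎)
  where
  open ≡-Reasoning
  X = sumFin (λ u → a u * lookup (laplacian G b) u)
  Y = sumFin (λ u → b u * lookup (laplacian G a) u)
  double : ∀ x → + 2 * x ≡ x + x
  double = solve-∀
  swap : ∀ au ax bu bx c → (au - ax) * (c * (bu - bx)) ≡ (bu - bx) * (c * (au - ax))
  swap = solve-∀

indicator≤ : ℤ → ℤ → ℤ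
indicator≤ t s = if does (t ℤ.≤? s) then 1ℤ else 0ℤ

indicator≤*-≤∣∣ : ∀ t s d → indicator≤ t s * d ≤ + ∣ d ∣
indicator≤*-≤∣∣ t s d with t ℤ.≤? s
... | yes _ = subst (_≤ + ∣ d ∣) (sym (ℤP.*-identityˡ d)) (i≤∣i∣ d)
... | no  _ = 0≤+ _

-- Across the cut {u : t ≤ f u} the flow only goes downhill.
cut-flow-nonNeg : ∀ {n} (G : Multigraph n) f t u x →
  0ℤ ≤ (indicator≤ t (f u) - indicator≤ t (f x)) * flow G f u x
cut-flow-nonNeg G f t u x with t ℤ.≤? f u | t ℤ.≤? f x
... | yes _ | yes _ = subst (0ℤ ≤_) (sym (ℤP.*-zeroˡ (flow G f u x))) ℤP.≤-refl
... | no  _ | no  _ = subst (0ℤ ≤_) (sym (ℤP.*-zeroˡ (flow G f u x))) ℤP.≤-refl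
... | yes t≤fu | no t≰fx = subst (0ℤ ≤_) (sym (ℤP.*-identityˡ (flow G f u x)))
        (0≤+* (adj G u x) (ℤP.i≤j⇒0≤j-i (ℤP.<⇒≤ (ℤP.<-≤-trans (ℤP.≰⇒> t≰fx) t≤fu))))
... | no t≰fu | yes t≤fx = subst (0ℤ ≤_) (sym (reverse (+ adj G u x) (f u) (f x)))
        (0≤+* (adj G u x) (ℤP.i≤j⇒0≤j-i (ℤP.<⇒≤ (ℤP.<-≤-trans (ℤP.≰⇒> t≰fu) t≤fx))))
  where
  reverse : ∀ c a b → (- 1ℤ) * (c * (a - b)) ≡ c * (b - a)
  reverse = solve-∀

edge-potential-bound : ∀ {n} (G : Multigraph n) (f : Fin n → ℤ) v w → 0 ℕ.< adj G v w →
  f v - f w ≤ l1norm (laplacian G f) + l1norm (laplacian G f)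
edge-potential-bound {n} G f v w 0<adj = begin
  f v - f w                                ≤⟨ drop≤cut (f v ℤ.≤? f w) ⟩
  cut v w                                  ≤⟨ term≤sumFin (cut v) (cut-flow-nonNeg G f (f v) v) w ⟩
  sumFin (cut v)                           ≤⟨ term≤sumFin (λ u → sumFin (cut u)) (λ u → sumFin-nonNeg (cut-flow-nonNeg G f (f v) u)) v ⟩
  sumFin (λ u → sumFin (cut u))            ≡⟨ laplacian-pairing G f χ ⟩
  T + T                                    ≤⟨ ℤP.+-mono-≤ T≤l1 T≤l1 ⟩
  l1norm D + l1norm D                      ∎
  where
  open ℤP.≤-Reasoning
  D = laplacian G f
  χ : Fin n → ℤ
  χ u = indicator≤ (f v) (f u)
  cut : Fin n → Fin n → ℤ
  cut u x = (χ u - χ x) * flow G f u x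
  T = sumFin (λ u → χ u * lookup D u)
  T≤l1 : T ≤ l1norm D
  T≤l1 = sumFin-mono (λ u → indicator≤*-≤∣∣ (f v) (f u) (lookup D u))
  drop≤cut : Dec (f v ≤ f w) → f v - f w ≤ cut v w
  drop≤cut (yes fv≤fw) = ℤP.≤-trans (ℤP.i≤j⇒i-j≤0 fv≤fw) (cut-flow-nonNeg G f (f v) v w)
  drop≤cut (no fv≰fw) with f v ℤ.≤? f v | f v ℤ.≤? f w
  ... | no fv≰fv | _ = ⊥-elim (fv≰fv ℤP.≤-refl)
  ... | _ | yes fv≤fw = ⊥-elim (fv≰fw fv≤fw)
  ... | yes _ | no _ = subst (f v - f w ≤_) (sym (ℤP.*-identityˡ (flow G f v w)))
        (subst (_≤ flow G f v w) (ℤP.*-identityˡ (f v - f w))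
          (ℤP.*-monoʳ-≤-nonNeg (f v - f w) {{ℤ.nonNegative 0≤drop}} (+≤+ 0<adj)))
    where
    0≤drop : 0ℤ ≤ f v - f w
    0≤drop = ℤP.i≤j⇒0≤j-i (ℤP.<⇒≤ (ℤP.≰⇒> fv≰fw))

walkLength : ∀ {n} {G : Multigraph n} {u v} → Reach G u v → ℕ
walkLength here       = 0
walkLength (step _ r) = suc (walkLength r)

walk-potential-bound : ∀ {n} (G : Multigraph n) (f : Fin n → ℤ) (K : ℤ) →
  (∀ v w → 0 ℕ.< adj G v w → f v - f w ≤ K) →
  ∀ {u v} (r : Reach G u v) → f u - f v ≤ K * + walkLength r × f v - f u ≤ K * + walkLength r
walk-potential-bound G f K edge {u} here =
  subst₂ _≤_ (sym (ℤP.+-inverseʳ (f u))) (sym (ℤP.*-zeroʳ K)) ℤP.≤-refl ,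
  subst₂ _≤_ (sym (ℤP.+-inverseʳ (f u))) (sym (ℤP.*-zeroʳ K)) ℤP.≤-refl
walk-potential-bound G f K edge {u} {v} (step {w = w} 0<adj r) =
  subst₂ _≤_ (sym (telescope (f u) (f w) (f v))) (sym (one-more K (+ walkLength r)))
    (ℤP.+-mono-≤ (edge u w 0<adj) (proj₁ ih)) ,
  subst₂ _≤_ (trans (ℤP.+-comm (f w - f u) (f v - f w)) (sym (telescope (f v) (f w) (f u))))
    (sym (one-more K (+ walkLength r)))
    (ℤP.+-mono-≤ (edge w u (subst (0 ℕ.<_) (Multigraph.sym G u w) 0<adj)) (proj₂ ih))
  where
  ih = walk-potential-bound G f K edge r
  telescope : ∀ a b c → a - c ≡ (a - b) + (b - c)
  telescope = solve-∀
  one-more : ∀ K x → K * (1ℤ + x) ≡ K + K * x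
  one-more = solve-∀

potentialBox : ∀ {n} (G : Multigraph n) → Connected G → Fin n → Div n → Fin n → List ℤ
potentialBox G conn q D u = interval ∣ (l1norm D + l1norm D) * + walkLength (conn u q) ∣

normalisedAt : ∀ {n} → Fin n → (Fin n → ℤ) → Div n
normalisedAt q f = tabulate (λ u → f u - f q)

laplacian-normalisedAt : ∀ {n} (G : Multigraph n) q f → laplacian G f ≡ laplacian G (lookup (normalisedAt q f))
laplacian-normalisedAt G q f = VP.tabulate-cong (λ v → sumFin-cong (λ w → cong ((+ adj G v w) *_) (begin
  f v - f w                                              ≡⟨ shift (f v) (f w) (f q) ⟩
  (f v - f q) - (f w - f q)                              ≡⟨ sym (cong₂ _-_ (VP.lookup∘tabulate _ v) (VP.lookup∘tabulate _ w)) ⟩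
  lookup (normalisedAt q f) v - lookup (normalisedAt q f) w ∎)))
  where
  open ≡-Reasoning
  shift : ∀ a b c → a - b ≡ (a - c) - (b - c)
  shift = solve-∀

normalisedAt∈potentialBox : ∀ {n} (G : Multigraph n) (conn : Connected G) q f →
  normalisedAt q f ∈ vecsOver (potentialBox G conn q (laplacian G f))
normalisedAt∈potentialBox G conn q f = ∈-vecsOver _ _ λ u →
  subst (_∈ potentialBox G conn q (laplacian G f) u) (sym (VP.lookup∘tabulate (λ u → f u - f q) u))
    (coordinate u)
  where
  K = l1norm (laplacian G f) + l1norm (laplacian G f)
  negate : ∀ a b → - (a - b) ≡ b - a
  negate = solve-∀
  coordinate : ∀ u → f u - f q ∈ interval ∣ K * + walkLength (conn u q) ∣
  coordinate u = ∈-interval _ _ (ℤP.≤-trans (proj₁ bound) (i≤∣i∣ _))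
                   (ℤP.≤-trans (subst (_≤ K * + walkLength (conn u q)) (sym (negate (f u) (f q))) (proj₂ bound)) (i≤∣i∣ _))
    where
    bound = walk-potential-bound G f K (edge-potential-bound G f) (conn u q)

-- A potential can be normalised to vanish at q, and is then bounded in terms of its
-- Laplacian, so it suffices to search a finite box.
principal? : ∀ {n} (G : Multigraph n) → Connected G → Fin n → (D : Div n) → Dec (Principal G D)
principal? {n} G conn q D
  with any? (λ g → VP.≡-dec ℤ._≟_ D (laplacian G (lookup g))) (vecsOver (potentialBox G conn q D))
... | yes found = yes (lookup (proj₁ (Any.satisfied found)) , proj₂ (Any.satisfied found))
... | no  none  = no λ where
  (f , refl) → none (lose (normalisedAt∈potentialBox G conn q f) (laplacian-normalisedAt G q f))

module _ (P : ℕ → Set) (P? : ∀ k → Dec (P k)) where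

  searchBelow : ∀ m → (Σ ℕ λ k → k ℕ.< m × P k × (∀ j → j ℕ.< k → ¬ P j)) ⊎ (∀ j → j ℕ.< m → ¬ P j)
  searchBelow zero = inj₂ (λ j ())
  searchBelow (suc m) with searchBelow m
  ... | inj₁ (k , k<m , pk , below) = inj₁ (k , ℕP.m<n⇒m<1+n k<m , pk , below)
  ... | inj₂ none with P? m
  ...   | yes pm = inj₁ (m , ℕP.n<1+n m , pm , none)
  ...   | no ¬pm = inj₂ λ j j<1+m → [ none j , (λ { refl → ¬pm }) ]′ (ℕP.m≤n⇒m<n∨m≡n (ℕP.≤-pred j<1+m))

  least-witness : ∀ m → P m → Σ ℕ λ k → P k × (∀ j → j ℕ.< k → ¬ P j)
  least-witness m pm with searchBelow (suc m)
  ... | inj₁ (k , _ , pk , below) = k , pk , below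
  ... | inj₂ none = ⊥-elim (none m (ℕP.n<1+n m) pm)

-- Chip-firing towards q and the finiteness of ord_q(v)

module ChipFiring {n} (G : Multigraph n) (conn : Connected G) (q : Fin n) where

  WithinDistance : ℕ → Fin n → Set
  WithinDistance zero    u = u ≡ q
  WithinDistance (suc k) u = u ≡ q ⊎ ∃ λ x → 0 ℕ.< adj G u x × WithinDistance k x

  withinDistance? : ∀ k u → Dec (WithinDistance k u)
  withinDistance? zero    u = u ≟ q
  withinDistance? (suc k) u = (u ≟ q) ⊎-dec FP.any? (λ x → (0 ℕ.<? adj G u x) ×-dec withinDistance? k x)

  walk⇒withinDistance : ∀ {u} (r : Reach G u q) → WithinDistance (walkLength r) u
  walk⇒withinDistance here         = refl
  walk⇒withinDistance (step 0<a r) = inj₂ (_ , 0<a , walk⇒withinDistance r)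

  distanceWitness : ∀ u → Σ ℕ λ k → WithinDistance k u × (∀ j → j ℕ.< k → ¬ WithinDistance j u)
  distanceWitness u = least-witness (λ k → WithinDistance k u) (λ k → withinDistance? k u)
                        (walkLength (conn u q)) (walk⇒withinDistance (conn u q))

  distance : Fin n → ℕ
  distance u = proj₁ (distanceWitness u)

  distance-minimal : ∀ u k → WithinDistance k u → distance u ℕ.≤ k
  distance-minimal u k within with distance u ℕ.≤? k
  ... | yes d≤k = d≤k
  ... | no  d≰k = ⊥-elim (proj₂ (proj₂ (distanceWitness u)) k (ℕP.≰⇒> d≰k) within)

  distance-q : distance q ≡ 0
  distance-q = ℕP.n≤0⇒n≡0 (distance-minimal q 0 refl)

  closer-neighbour : ∀ u → u ≢ q → ∃ λ x → 0 ℕ.< adj G u x × distance x ℕ.< distance u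
  closer-neighbour u u≢q with distanceWitness u
  ... | zero  , u≡q , _                 = ⊥-elim (u≢q u≡q)
  ... | suc k , inj₁ u≡q , _            = ⊥-elim (u≢q u≡q)
  ... | suc k , inj₂ (x , 0<a , wx) , _ = x , 0<a , s≤s (distance-minimal x k wx)

  -- Weights grow geometrically towards q, by a factor exceeding every valence.
  valence : Fin n → ℕ
  valence u = sumℕ (adj G u)

  base : ℕ
  base = suc (suc (sumℕ valence))

  weight : Fin n → ℕ
  weight u = base ^ (sumℕ distance ∸ distance u)

  weight-pos : ∀ u → 1 ℕ.≤ weight u
  weight-pos u = ℕP.m^n>0 base (sumℕ distance ∸ distance u)

  weight≤weight-q : ∀ u → weight u ℕ.≤ weight q
  weight≤weight-q u = ℕP.^-monoʳ-≤ base
    (subst (λ d → sumℕ distance ∸ distance u ℕ.≤ sumℕ distance ∸ d) (sym distance-q)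
           (ℕP.m∸n≤m (sumℕ distance) (distance u)))

  weight-closer : ∀ u x → distance x ℕ.< distance u → base ℕ.* weight u ℕ.≤ weight x
  weight-closer u x closer = ℕP.^-monoʳ-≤ base {suc (sumℕ distance ∸ distance u)}
    (subst (ℕ._≤ sumℕ distance ∸ distance x) (ℕP.+-∸-assoc 1 (term≤sumℕ distance u))
           (ℕP.∸-monoʳ-≤ (suc (sumℕ distance)) closer))

  W : Fin n → ℤ
  W u = + weight u

  gain : Fin n → ℤ
  gain w = sumFin (λ x → (+ adj G w x) * (W x - W w))

  gain≡ : ∀ w → gain w ≡ + sumℕ (λ x → adj G w x ℕ.* weight x) - + (valence w ℕ.* weight w)
  gain≡ w = begin
    gain w                                                          ≡⟨ sumFin-cong (λ x → expand (+ adj G w x) (W x) (W w)) ⟩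
    sumFin (λ x → (+ adj G w x) * W x - W w * + adj G w x)         ≡⟨ sumFin-- _ (λ x → W w * + adj G w x) ⟩
    sumFin (λ x → (+ adj G w x) * W x) - sumFin (λ x → W w * + adj G w x)
                                                                    ≡⟨ cong₂ _-_ inflow outflow ⟩
    + sumℕ (λ x → adj G w x ℕ.* weight x) - + (valence w ℕ.* weight w) ∎
    where
    open ≡-Reasoning
    expand : ∀ a b c → a * (b - c) ≡ a * b - c * a
    expand = solve-∀
    inflow : sumFin (λ x → (+ adj G w x) * W x) ≡ + sumℕ (λ x → adj G w x ℕ.* weight x)
    inflow = trans (sumFin-cong (λ x → sym (ℤP.pos-* (adj G w x) (weight x))))
                   (sumFin-fromℕ (λ x → adj G w x ℕ.* weight x))
    outflow : sumFin (λ x → W w * + adj G w x) ≡ + (valence w ℕ.* weight w)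
    outflow = trans (sumFin-*ˡ (W w) (λ x → + adj G w x))
               (trans (cong (W w *_) (sumFin-fromℕ (adj G w)))
                (trans (sym (ℤP.pos-* (weight w) (valence w))) (cong +_ (ℕP.*-comm (weight w) (valence w)))))

  gain-pos : ∀ w → w ≢ q → 1ℤ ≤ gain w
  gain-pos w w≢q = subst (1ℤ ≤_) (sym (trans (gain≡ w) (m-n≡∸ (ℕP.<⇒≤ out<in))))
                         (+≤+ (ℕP.m<n⇒0<n∸m out<in))
    where
    out<in : valence w ℕ.* weight w ℕ.< sumℕ (λ x → adj G w x ℕ.* weight x)
    out<in with closer-neighbour w w≢q
    ... | x , 0<a , closer = begin-strict
      valence w ℕ.* weight w                     <⟨ ℕP.+-mono-≤ (weight-pos w) (ℕP.m≤n+m _ (weight w)) ⟩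
      suc (suc (valence w)) ℕ.* weight w         ≤⟨ ℕP.*-monoˡ-≤ (weight w) (s≤s (s≤s (term≤sumℕ valence w))) ⟩
      base ℕ.* weight w                          ≤⟨ weight-closer w x closer ⟩
      weight x                                   ≤⟨ ℕP.m≤n*m (weight x) (adj G w x) {{ℕ.>-nonZero 0<a}} ⟩
      adj G w x ℕ.* weight x                     ≤⟨ term≤sumℕ (λ x → adj G w x ℕ.* weight x) x ⟩
      sumℕ (λ x → adj G w x ℕ.* weight x)        ∎
      where open ℕP.≤-Reasoning

  energy : Div n → ℤ
  energy D = sumFin (λ u → W u * lookup D u)

  firing : Fin n → Div n
  firing w = laplacian G (lookup (unit w))

  fire : Fin n → Div n → Div n
  fire w D = D ⊖ firing w

  energy-fire : ∀ w D → energy (fire w D) ≡ energy D + gain w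
  energy-fire w D = begin
    energy (fire w D)                                        ≡⟨ sumFin-cong (λ u → trans (cong (W u *_) (lookup-⊖ D (firing w) u))
                                                                                     (*-distrib-- (W u) (lookup D u) _)) ⟩
    sumFin (λ u → W u * lookup D u - W u * lookup (firing w) u) ≡⟨ sumFin-- (λ u → W u * lookup D u) _ ⟩
    energy D - sumFin (λ u → W u * lookup (firing w) u)      ≡⟨ cong (λ z → energy D - z) paired ⟩
    energy D - - gain w                                      ≡⟨ cong (λ z → energy D + z) (ℤP.neg-involutive (gain w)) ⟩
    energy D + gain w                                        ∎
    where
    open ≡-Reasoning
    *-distrib-- : ∀ a b c → a * (b - c) ≡ a * b - a * c
    *-distrib-- = solve-∀
    flip : ∀ c x y → c * (y - x) ≡ - (c * (x - y))
    flip = solve-∀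
    LW : Fin n → ℤ
    LW = lookup (laplacian G W)
    paired : sumFin (λ u → W u * lookup (firing w) u) ≡ - gain w
    paired = begin
      sumFin (λ u → W u * lookup (firing w) u)                ≡⟨ laplacian-selfAdjoint G W (lookup (unit w)) ⟩
      sumFin (λ u → lookup (unit w) u * lookup (laplacian G W) u)
                                                               ≡⟨ sumFin-single (λ u → lookup (unit w) u * LW u) w (λ u u≢w →
                                                                    trans (cong (_* LW u) (lookup-unit-other (λ w≡u → u≢w (sym w≡u))))
                                                                          (ℤP.*-zeroˡ (LW u))) ⟩
      lookup (unit w) w * lookup (laplacian G W) w             ≡⟨ trans (cong (_* LW w) (lookup-unit-same w)) (ℤP.*-identityˡ (LW w)) ⟩
      lookup (laplacian G W) w                                 ≡⟨ lookup-laplacian G W w ⟩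
      sumFin (flow G W w)                                      ≡⟨ sumFin-cong (λ x → flip (+ adj G w x) (W x) (W w)) ⟩
      sumFin (λ x → - ((+ adj G w x) * (W x - W w)))           ≡⟨ sumFin-neg (λ x → (+ adj G w x) * (W x - W w)) ⟩
      - gain w                                                 ∎

  Admissible : Div n → Set
  Admissible D = (∀ w → w ≢ q → 0ℤ ≤ lookup D w) × deg D ≡ 0ℤ

  -- All weights are at most the weight at q, where an admissible divisor has its only negative entry.
  energy-nonPos : ∀ D → Admissible D → energy D ≤ 0ℤ
  energy-nonPos D (nonNeg , deg≡0) = begin
    energy D                                                   ≡⟨ sumFin-cong (λ u → split (W u) (W q) (lookup D u)) ⟩
    sumFin (λ u → (W u - W q) * lookup D u + W q * lookup D u) ≡⟨ sumFin-+ _ (λ u → W q * lookup D u) ⟩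
    sumFin (λ u → (W u - W q) * lookup D u) + sumFin (λ u → W q * lookup D u)
                                                               ≡⟨ cong (λ z → sumFin (λ u → (W u - W q) * lookup D u) + z) q-part ⟩
    sumFin (λ u → (W u - W q) * lookup D u) + 0ℤ               ≤⟨ ℤP.+-monoˡ-≤ 0ℤ (sumFin-nonPos term) ⟩
    0ℤ + 0ℤ                                                    ≡⟨⟩
    0ℤ                                                         ∎
    where
    open ℤP.≤-Reasoning
    split : ∀ w wq d → w * d ≡ (w - wq) * d + wq * d
    split = solve-∀
    q-part : sumFin (λ u → W q * lookup D u) ≡ 0ℤ
    q-part = trans (sumFin-*ˡ (W q) (lookup D)) (trans (cong (W q *_) deg≡0) (ℤP.*-zeroʳ (W q)))
    term : ∀ u → (W u - W q) * lookup D u ≤ 0ℤ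
    term u with u ≟ q
    ... | yes refl = ℤP.≤-reflexive (trans (cong (_* lookup D u) (ℤP.+-inverseʳ (W u))) (ℤP.*-zeroˡ (lookup D u)))
    ... | no u≢q   = subst ((W u - W q) * lookup D u ≤_) (ℤP.*-zeroˡ (lookup D u))
                       (ℤP.*-monoʳ-≤-nonNeg (lookup D u) {{ℤ.nonNegative (nonNeg u u≢q)}}
                          (ℤP.i≤j⇒i-j≤0 (+≤+ (weight≤weight-q u))))

  sent : Fin n → ℤ
  sent w = lookup (firing w) w

  firing-other≤0 : ∀ w y → w ≢ y → lookup (firing w) y ≤ 0ℤ
  firing-other≤0 w y w≢y = subst (_≤ 0ℤ) (sym (lookup-laplacian G (lookup (unit w)) y)) (sumFin-nonPos term)
    where
    term : ∀ x → flow G (lookup (unit w)) y x ≤ 0ℤ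
    term x = subst (_≤ 0ℤ) (sym (trans (cong (λ z → (+ adj G y x) * (z - lookup (unit w) x)) (lookup-unit-other w≢y))
                                      (outflow (+ adj G y x) (lookup (unit w) x))))
                   (ℤP.neg-mono-≤ (0≤+* (adj G y x) (unit-nonNeg w x)))
      where
      outflow : ∀ c z → c * (0ℤ - z) ≡ - (c * z)
      outflow = solve-∀

  fire-admissible : ∀ w D → w ≢ q → sent w ≤ lookup D w → Admissible D → Admissible (fire w D)
  fire-admissible w D w≢q ready (nonNeg , deg≡0) = nonNeg′ , deg′
    where
    nonNeg′ : ∀ y → y ≢ q → 0ℤ ≤ lookup (fire w D) y
    nonNeg′ y y≢q with w ≟ y
    ... | yes refl = subst (0ℤ ≤_) (sym (lookup-⊖ D (firing w) w)) (ℤP.i≤j⇒0≤j-i ready)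
    ... | no  w≢y  = subst (0ℤ ≤_) (sym (lookup-⊖ D (firing w) y))
                       (ℤP.≤-trans (nonNeg y y≢q)
                          (subst (_≤ lookup D y - lookup (firing w) y) (ℤP.+-identityʳ (lookup D y))
                             (ℤP.+-monoʳ-≤ (lookup D y) (ℤP.neg-mono-≤ (firing-other≤0 w y w≢y)))))
    deg′ : deg (fire w D) ≡ 0ℤ
    deg′ = trans (deg-⊖ D (firing w)) (cong₂ _-_ deg≡0 (deg-laplacian G (lookup (unit w))))

  fire-∼ : ∀ w D → D ∼⟨ G ⟩ fire w D
  fire-∼ w D = principal-pointwise G (lookup (unit w) , refl) (D ⊖ fire w D) λ u →
    trans (lookup-⊖ D (fire w D) u)
     (trans (cong (λ z → lookup D u - z) (lookup-⊖ D (firing w) u)) (cancel (lookup D u) _))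
    where
    cancel : ∀ a b → a - (a - b) ≡ b
    cancel = solve-∀

  Stable : Div n → Set
  Stable D = ∀ w → w ≢ q → lookup D w < sent w

  -- Each firing raises the energy by at least 1, and the energy of an admissible divisor is
  -- at most 0, so at most -energy D firings can happen.
  stabilise : ∀ m D → Admissible D → - energy D ≤ + m →
    Σ (Div n) λ D′ → D ∼⟨ G ⟩ D′ × Admissible D′ × Stable D′
  stabilise m D adm fuel with FP.any? (λ w → ¬? (w ≟ q) ×-dec (sent w ℤ.≤? lookup D w))
  ... | no none = D , ∼-refl G D , adm , λ w w≢q → ℤP.≰⇒> (λ ready → none (w , w≢q , ready))
  ... | yes (w , w≢q , ready) = fireAndContinue m fuel
    where
    adm′ : Admissible (fire w D)
    adm′ = fire-admissible w D w≢q ready adm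
    fireAndContinue : ∀ m → - energy D ≤ + m → Σ (Div n) λ D′ → D ∼⟨ G ⟩ D′ × Admissible D′ × Stable D′
    fireAndContinue zero fuel = ⊥-elim (ℤP.<⇒≱ 0<energy′ (energy-nonPos (fire w D) adm′))
      where
      0≤energy : 0ℤ ≤ energy D
      0≤energy = subst (0ℤ ≤_) (ℤP.neg-involutive (energy D)) (ℤP.neg-mono-≤ fuel)
      0<energy′ : 0ℤ < energy (fire w D)
      0<energy′ = subst (0ℤ <_) (sym (energy-fire w D))
                    (ℤP.+-mono-≤-< {0ℤ} {energy D} {0ℤ} {gain w} 0≤energy (ℤP.<-≤-trans (+<+ (s≤s z≤n)) (gain-pos w w≢q)))
    fireAndContinue (suc m) fuel = extend (stabilise m (fire w D) adm′ fuel′)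
      where
      fuel′ : - energy (fire w D) ≤ + m
      fuel′ = subst (_≤ + m) (sym (trans (cong -_ (energy-fire w D)) (ℤP.neg-distrib-+ (energy D) (gain w))))
                (ℤP.+-mono-≤ fuel (ℤP.neg-mono-≤ (gain-pos w w≢q)))
      extend : (Σ (Div n) λ D′ → fire w D ∼⟨ G ⟩ D′ × Admissible D′ × Stable D′) →
               Σ (Div n) λ D′ → D ∼⟨ G ⟩ D′ × Admissible D′ × Stable D′
      extend (D′ , fire∼D′ , adm″ , stable) = D′ , ∼-trans G (fire-∼ w D) fire∼D′ , adm″ , stable

  sentBound : ℕ
  sentBound = sumℕ (λ u → ∣ sent u ∣)

  ∣sent∣≤sentBound : ∀ u → + ∣ sent u ∣ ≤ + sentBound
  ∣sent∣≤sentBound u = subst (+ ∣ sent u ∣ ≤_) (sumFin-fromℕ (λ u → ∣ sent u ∣))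
                         (term≤sumFin (λ u → + ∣ sent u ∣) (λ u → 0≤+ _) u)

  stable-bounded : ∀ D → Admissible D → Stable D → ∀ u → lookup D u ≤ + sentBound × - lookup D u ≤ + sentBound
  stable-bounded D (nonNeg , deg≡0) stable u with u ≟ q
  ... | no u≢q = ℤP.≤-trans (ℤP.<⇒≤ (stable u u≢q)) (ℤP.≤-trans (i≤∣i∣ (sent u)) (∣sent∣≤sentBound u)) ,
                 ℤP.≤-trans (ℤP.neg-mono-≤ (nonNeg u u≢q)) (0≤+ _)
  ... | yes refl = ℤP.≤-trans (subst (_≤ 0ℤ) (ℤP.neg-involutive (lookup D q)) (ℤP.neg-mono-≤ 0≤-Dq)) (0≤+ _) ,
                   subst (_≤ + sentBound) ΣwithoutQ≡-Dq
                     (subst (sumFin withoutQ ≤_) (sumFin-fromℕ (λ u → ∣ sent u ∣)) (sumFin-mono (λ x → proj₂ (withoutQ-bounds x))))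
    where
    withoutQ : Fin n → ℤ
    withoutQ x = lookup D x - lookup D q * lookup (unit q) x
    self : ∀ a → a - a * 1ℤ ≡ 0ℤ
    self = solve-∀
    drop : ∀ a b → a - b * 0ℤ ≡ a
    drop = solve-∀
    withoutQ-bounds : ∀ x → 0ℤ ≤ withoutQ x × withoutQ x ≤ + ∣ sent x ∣
    withoutQ-bounds x with x ≟ q
    ... | yes refl = subst (λ z → 0ℤ ≤ z × z ≤ + ∣ sent q ∣)
                       (sym (trans (cong (λ z → lookup D q - lookup D q * z) (lookup-unit-same q)) (self (lookup D q))))
                       (ℤP.≤-refl , 0≤+ _)
    ... | no x≢q = subst (λ z → 0ℤ ≤ z × z ≤ + ∣ sent x ∣)
                     (sym (trans (cong (λ z → lookup D x - lookup D q * z) (lookup-unit-other (λ q≡x → x≢q (sym q≡x))))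
                                 (drop (lookup D x) (lookup D q))))
                     (nonNeg x x≢q , ℤP.≤-trans (ℤP.<⇒≤ (stable x x≢q)) (i≤∣i∣ (sent x)))
    ΣwithoutQ≡-Dq : sumFin withoutQ ≡ - lookup D q
    ΣwithoutQ≡-Dq = trans (sumFin-- (lookup D) (λ x → lookup D q * lookup (unit q) x))
                 (trans (cong₂ _-_ deg≡0 (trans (sumFin-*ˡ (lookup D q) (lookup (unit q))) (cong (lookup D q *_) (deg-unit q))))
                        (negate (lookup D q)))
      where
      negate : ∀ a → 0ℤ - a * 1ℤ ≡ - a
      negate = solve-∀
    0≤-Dq : 0ℤ ≤ - lookup D q
    0≤-Dq = subst (0ℤ ≤_) ΣwithoutQ≡-Dq (sumFin-nonNeg (λ x → proj₁ (withoutQ-bounds x)))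

  stableCandidates : List (Div n)
  stableCandidates = vecsOver (λ _ → interval sentBound)

  stable∈stableCandidates : ∀ D → Admissible D → Stable D → D ∈ stableCandidates
  stable∈stableCandidates D adm stable = ∈-vecsOver _ D λ u →
    ∈-interval sentBound _ (proj₁ (stable-bounded D adm stable u)) (proj₂ (stable-bounded D adm stable u))

  module _ (v : Fin n) where

    multiple : ℕ → Div n
    multiple k = (+ k) · (unit v ⊖ unit q)

    multiple-admissible : ∀ k → Admissible (multiple k)
    multiple-admissible k = nonNeg , deg-unit-difference (+ k) v q
      where
      nonNeg : ∀ w → w ≢ q → 0ℤ ≤ lookup (multiple k) w
      nonNeg w w≢q = subst (0ℤ ≤_)
        (sym (trans (lookup-· (+ k) (unit v ⊖ unit q) w)
               (cong (+ k *_) (trans (lookup-⊖ (unit v) (unit q) w)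
                 (trans (cong (λ z → lookup (unit v) w - z) (lookup-unit-other (λ q≡w → w≢q (sym q≡w))))
                        (ℤP.+-identityʳ _))))))
        (0≤+* k (unit-nonNeg v w))

    multiple-difference : ∀ i j → i ℕ.< j → multiple j ∼⟨ G ⟩ multiple i →
      Principal G (multiple (j ∸ i))
    multiple-difference i j i<j mj∼mi = principal-pointwise G mj∼mi (multiple (j ∸ i)) λ u →
      trans (lookup-· (+ (j ∸ i)) (unit v ⊖ unit q) u)
       (trans (cong (_* d u) (sym (m-n≡∸ (ℕP.<⇒≤ i<j))))
        (trans (*-distribʳ-- (+ j) (+ i) (d u))
         (sym (trans (lookup-⊖ (multiple j) (multiple i) u)
                     (cong₂ _-_ (lookup-· (+ j) (unit v ⊖ unit q) u) (lookup-· (+ i) (unit v ⊖ unit q) u))))))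
      where
      d = lookup (unit v ⊖ unit q)
      *-distribʳ-- : ∀ a b x → (a - b) * x ≡ a * x - b * x
      *-distribʳ-- = solve-∀

    stabilised : ∀ k → Σ (Div n) λ D′ → multiple k ∼⟨ G ⟩ D′ × Admissible D′ × Stable D′
    stabilised k = stabilise ∣ - energy (multiple k) ∣ (multiple k) (multiple-admissible k) (i≤∣i∣ _)

    stableForm : ℕ → Div n
    stableForm k = proj₁ (stabilised k)

    multiple∼stableForm : ∀ k → multiple k ∼⟨ G ⟩ stableForm k
    multiple∼stableForm k = proj₁ (proj₂ (stabilised k))

    stableForm∈candidates : ∀ k → stableForm k ∈ stableCandidates
    stableForm∈candidates k =
      stable∈stableCandidates (stableForm k) (proj₁ (proj₂ (proj₂ (stabilised k)))) (proj₂ (proj₂ (proj₂ (stabilised k))))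

    -- Pigeonhole: two of the first |stableCandidates| + 1 multiples share a stable form.
    positive-multiple-principal : Σ ℕ λ N → 0 ℕ.< N × Principal G (multiple N)
    positive-multiple-principal = fromCollision (FP.pigeonhole (ℕP.n<1+n (length stableCandidates)) slot)
      where
      slot : Fin (suc (length stableCandidates)) → Fin (length stableCandidates)
      slot k = Any.index (stableForm∈candidates (toℕ k))
      fromCollision : (∃ λ i → ∃ λ j → i F.< j × slot i ≡ slot j) → Σ ℕ λ N → 0 ℕ.< N × Principal G (multiple N)
      fromCollision (i , j , i<j , same) = toℕ j ∸ toℕ i , ℕP.m<n⇒0<n∸m i′<j′ ,
        multiple-difference (toℕ i) (toℕ j) i′<j′
          (∼-trans G (multiple∼stableForm (toℕ j))
            (subst (λ E → E ∼⟨ G ⟩ multiple (toℕ i)) sameForm (∼-sym G (multiple∼stableForm (toℕ i)))))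
        where
        i′<j′ = FP.toℕ-mono-< i<j
        sameForm : stableForm (toℕ i) ≡ stableForm (toℕ j)
        sameForm = trans (AnyP.lookup-index (stableForm∈candidates (toℕ i)))
                    (trans (cong (L.lookup stableCandidates) same) (sym (AnyP.lookup-index (stableForm∈candidates (toℕ j)))))

    opaque
      order-exists : Σ ℕ (IsOrd G q v)
      order-exists = minimise positive-multiple-principal
        where
        minimise : (Σ ℕ λ N → 0 ℕ.< N × Principal G (multiple N)) → Σ ℕ (IsOrd G q v)
        minimise (suc N , _ , principalN) = fromLeast (least-witness (λ k → Principal G (multiple (suc k)))
                                              (λ k → principal? G conn q (multiple (suc k))) N principalN)
          where
          fromLeast : (Σ ℕ λ k → Principal G (multiple (suc k)) × (∀ j → j ℕ.< k → ¬ Principal G (multiple (suc j)))) →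
            Σ ℕ (IsOrd G q v)
          fromLeast (k , principalk , below) = suc k , s≤s z≤n , principalk , minimal
            where
            minimal : ∀ m → 0 ℕ.< m → m ℕ.< suc k → ¬ Principal G (multiple m)
            minimal (suc m) _ m<k = below m (ℕP.≤-pred m<k)

lookup-comb : ∀ {n} (𝒫 : List (Div n)) a u →
  lookup (comb 𝒫 a) u ≡ sumFin (λ i → + a i * lookup (L.lookup 𝒫 i) u)
lookup-comb []      a u = lookup-zeroDiv u
lookup-comb (X ∷ 𝒫) a u =
  trans (lookup-⊕ ((+ a zero) · X) (comb 𝒫 (λ i → a (suc i))) u)
        (cong₂ _+_ (lookup-· (+ a zero) X u) (lookup-comb 𝒫 (λ i → a (suc i)) u))

reduced : ∀ {n} → Fin n → Div n → Div n
reduced q E = E ⊖ (deg E · unit q)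

reduced-lincomb : ∀ {n} (q : Fin n) (X Y Z : Div n) a b →
  (∀ u → lookup Z u ≡ a * lookup X u + b * lookup Y u) →
  ∀ u → lookup (reduced q Z) u ≡ a * lookup (reduced q X) u + b * lookup (reduced q Y) u
reduced-lincomb q X Y Z a b h u = begin
  lookup (reduced q Z) u                         ≡⟨ lookup-reduced Z ⟩
  lookup Z u - deg Z * e                         ≡⟨ cong₂ (λ s t → s - t * e) (h u) (deg-lincomb X Y Z a b h) ⟩
  (a * lookup X u + b * lookup Y u) - (a * deg X + b * deg Y) * e
                                                 ≡⟨ regroup a b (lookup X u) (lookup Y u) (deg X) (deg Y) e ⟩
  a * (lookup X u - deg X * e) + b * (lookup Y u - deg Y * e)
                                                 ≡⟨ sym (cong₂ (λ s t → a * s + b * t) (lookup-reduced X) (lookup-reduced Y)) ⟩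
  a * lookup (reduced q X) u + b * lookup (reduced q Y) u ∎
  where
  open ≡-Reasoning
  e = lookup (unit q) u
  lookup-reduced : ∀ E → lookup (reduced q E) u ≡ lookup E u - deg E * e
  lookup-reduced E = trans (lookup-⊖ E (deg E · unit q) u) (cong (λ z → lookup E u - z) (lookup-· (deg E) (unit q) u))
  regroup : ∀ a b x y dx dy e → (a * x + b * y) - (a * dx + b * dy) * e ≡ a * (x - dx * e) + b * (y - dy * e)
  regroup = solve-∀

reduced-∼-lincomb : ∀ {n} (G : Multigraph n) q {X Y D E : Div n} → reduced q X ∼⟨ G ⟩ D → reduced q Y ∼⟨ G ⟩ E →
  ∀ a b (Z D′ : Div n) → (∀ u → lookup Z u ≡ a * lookup X u + b * lookup Y u) →
  (∀ u → lookup D′ u ≡ a * lookup D u + b * lookup E u) → reduced q Z ∼⟨ G ⟩ D′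
reduced-∼-lincomb G q {X} {Y} {D} {E} X∼D Y∼E a b Z D′ hZ hD′ =
  principal-lincomb G X∼D Y∼E a b (reduced q Z ⊖ D′) λ u → begin
    lookup (reduced q Z ⊖ D′) u                              ≡⟨ lookup-⊖ (reduced q Z) D′ u ⟩
    lookup (reduced q Z) u - lookup D′ u                     ≡⟨ cong₂ _-_ (reduced-lincomb q X Y Z a b hZ u) (hD′ u) ⟩
    (a * rX u + b * rY u) - (a * lookup D u + b * lookup E u) ≡⟨ regroup a b (rX u) (rY u) (lookup D u) (lookup E u) ⟩
    a * (rX u - lookup D u) + b * (rY u - lookup E u)        ≡⟨ sym (cong₂ (λ s t → a * s + b * t)
                                                                  (lookup-⊖ (reduced q X) D u) (lookup-⊖ (reduced q Y) E u)) ⟩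
    a * lookup (reduced q X ⊖ D) u + b * lookup (reduced q Y ⊖ E) u ∎
  where
  open ≡-Reasoning
  rX = lookup (reduced q X)
  rY = lookup (reduced q Y)
  regroup : ∀ a b x y d e → (a * x + b * y) - (a * d + b * e) ≡ a * (x - d) + b * (y - e)
  regroup = solve-∀

module _ {n} (G : Multigraph n) (q : Fin n) where

  inE-zeroDiv : InE G q zeroDiv zeroDiv
  inE-zeroDiv = (λ u → subst (0ℤ ≤_) (sym (lookup-zeroDiv u)) ℤP.≤-refl) ,
    principal-pointwise G (principal-zeroDiv G) (reduced q zeroDiv ⊖ zeroDiv) λ u →
      trans (lookup-⊖ (reduced q zeroDiv) zeroDiv u)
       (trans (cong₂ _-_ (reduced-lincomb q zeroDiv zeroDiv zeroDiv 0ℤ 0ℤ lookup-zeroDiv u)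
                         (lookup-zeroDiv u))
              (sym (lookup-zeroDiv u)))

  inE-⊕ : ∀ {D F Y} → InE G q D F → InE G q zeroDiv Y → InE G q D (F ⊕ Y)
  inE-⊕ {D} {F} {Y} (effF , F∼D) (effY , Y∼0) =
    (λ u → subst (0ℤ ≤_) (sym (lookup-⊕ F Y u)) (ℤP.+-mono-≤ (effF u) (effY u))) ,
    reduced-∼-lincomb G q F∼D Y∼0 1ℤ 1ℤ (F ⊕ Y) D
      (λ u → trans (lookup-⊕ F Y u) (sym (cong₂ _+_ (ℤP.*-identityˡ (lookup F u)) (ℤP.*-identityˡ (lookup Y u)))))
      (λ u → sym (trans (cong₂ _+_ (ℤP.*-identityˡ (lookup D u)) (trans (ℤP.*-identityˡ (lookup zeroDiv u)) (lookup-zeroDiv u)))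
                        (ℤP.+-identityʳ (lookup D u))))

  inE-⊖ : ∀ {D E Y} → InE G q D E → InE G q zeroDiv Y → Effective (E ⊖ Y) → InE G q D (E ⊖ Y)
  inE-⊖ {D} {E} {Y} (_ , E∼D) (_ , Y∼0) eff = eff ,
    reduced-∼-lincomb G q E∼D Y∼0 1ℤ (- 1ℤ) (E ⊖ Y) D
      (λ u → trans (lookup-⊖ E Y u) (sym (cong₂ _+_ (ℤP.*-identityˡ (lookup E u)) (ℤP.-1*i≡-i (lookup Y u)))))
      (λ u → sym (trans (cong₂ _+_ (ℤP.*-identityˡ (lookup D u)) (cong (- 1ℤ *_) (lookup-zeroDiv u))) (ℤP.+-identityʳ (lookup D u))))

  inE-· : ∀ {X} → InE G q zeroDiv X → ∀ k → InE G q zeroDiv ((+ k) · X)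
  inE-· {X} (effX , X∼0) k =
    (λ u → subst (0ℤ ≤_) (sym (lookup-· (+ k) X u)) (0≤+* k (effX u))) ,
    reduced-∼-lincomb G q X∼0 X∼0 (+ k) 0ℤ ((+ k) · X) zeroDiv
      (λ u → trans (lookup-· (+ k) X u) (sym (ℤP.+-identityʳ _)))
      (λ u → trans (lookup-zeroDiv u) (sym (trans (ℤP.+-identityʳ _) (trans (cong (+ k *_) (lookup-zeroDiv u)) (ℤP.*-zeroʳ (+ k))))))

  inE-∼ : ∀ {D D′ E} → D ∼⟨ G ⟩ D′ → InE G q D E → InE G q D′ E
  inE-∼ D∼D′ (effE , E∼D) = effE , ∼-trans G E∼D D∼D′

  inE-comb : ∀ (𝒫 : List (Div n)) → (∀ X → X ∈ 𝒫 → InE G q zeroDiv X) → ∀ a → InE G q zeroDiv (comb 𝒫 a)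
  inE-comb []      _   a = inE-zeroDiv
  inE-comb (X ∷ 𝒫) inE a =
    inE-⊕ (inE-· (inE X (here refl)) (a zero)) (inE-comb 𝒫 (λ Y Y∈𝒫 → inE Y (there Y∈𝒫)) (λ i → a (suc i)))

  -- c v ∈ 𝔼_[0] says exactly that c (v - q) is principal.
  reduced-·unit : ∀ c v u → lookup (reduced q ((+ c) · unit v) ⊖ zeroDiv) u ≡ lookup ((+ c) · (unit v ⊖ unit q)) u
  reduced-·unit c v u = begin
    lookup (reduced q cv ⊖ zeroDiv) u                  ≡⟨ lookup-⊖ (reduced q cv) zeroDiv u ⟩
    lookup (reduced q cv) u - lookup zeroDiv u         ≡⟨ cong₂ _-_ (lookup-⊖ cv (deg cv · unit q) u) (lookup-zeroDiv u) ⟩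
    lookup cv u - lookup (deg cv · unit q) u - 0ℤ      ≡⟨ cong₂ (λ s t → s - t - 0ℤ) (lookup-· (+ c) (unit v) u)
                                                            (trans (lookup-· (deg cv) (unit q) u)
                                                                   (cong (_* lookup (unit q) u) (trans (deg-· (+ c) (unit v))
                                                                                                      (cong (+ c *_) (deg-unit v))))) ⟩
    + c * ev - + c * 1ℤ * eq - 0ℤ                      ≡⟨ factor (+ c) ev eq ⟩
    + c * (ev - eq)                                    ≡⟨ sym (trans (lookup-· (+ c) (unit v ⊖ unit q) u)
                                                                     (cong (+ c *_) (lookup-⊖ (unit v) (unit q) u))) ⟩
    lookup ((+ c) · (unit v ⊖ unit q)) u               ∎
    where
    open ≡-Reasoning
    cv = (+ c) · unit v
    ev = lookup (unit v) u
    eq = lookup (unit q) u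
    factor : ∀ c ev eq → c * ev - c * 1ℤ * eq - 0ℤ ≡ c * (ev - eq)
    factor = solve-∀

  inE₀-·unit : ∀ c v → Principal G ((+ c) · (unit v ⊖ unit q)) → InE G q zeroDiv ((+ c) · unit v)
  inE₀-·unit c v principal = ·unit-effective c v ,
    principal-pointwise G principal (reduced q ((+ c) · unit v) ⊖ zeroDiv) (reduced-·unit c v)

  inE₀-·unit⁻¹ : ∀ c v → InE G q zeroDiv ((+ c) · unit v) → Principal G ((+ c) · (unit v ⊖ unit q))
  inE₀-·unit⁻¹ c v (_ , principal) =
    principal-pointwise G principal ((+ c) · (unit v ⊖ unit q)) (λ u → sym (reduced-·unit c v u))

posMultOfOrd-pos : ∀ {n} (G : Multigraph n) (q v : Fin n) {ℓ} → PosMultOfOrd G q v ℓ → 0 ℕ.< ℓ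
posMultOfOrd-pos G q v (suc o , _ , suc m , _ , refl) = s≤s z≤n

posMultOfOrd⇒principal : ∀ {n} (G : Multigraph n) (q v : Fin n) {ℓ} → PosMultOfOrd G q v ℓ →
  Principal G ((+ ℓ) · (unit v ⊖ unit q))
posMultOfOrd⇒principal G q v (o , (_ , principal , _) , m , _ , refl) =
  principal-scale G principal (+ m) _ λ u →
    trans (lookup-· (+ (m ℕ.* o)) (unit v ⊖ unit q) u)
     (trans (cong (_* lookup (unit v ⊖ unit q) u) (ℤP.pos-* m o))
      (trans (ℤP.*-assoc (+ m) (+ o) _) (cong (+ m *_) (sym (lookup-· (+ o) (unit v ⊖ unit q) u)))))

principal⇒posMultOfOrd : ∀ {n} (G : Multigraph n) (q v : Fin n) {o c} → IsOrd G q v o → 0 ℕ.< c →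
  Principal G ((+ c) · (unit v ⊖ unit q)) → PosMultOfOrd G q v c
principal⇒posMultOfOrd G q v {o@(suc _)} {c} ord@(_ , principalo , below) 0<c principalc =
  divide (c ℕD.% o) (c ℕD./ o) (ℕD.m%n<n c o) (ℕD.m≡m%n+[m/n]*n c o)
  where
  d = lookup (unit v ⊖ unit q)
  divide : ∀ r k → r ℕ.< o → c ≡ r ℕ.+ k ℕ.* o → PosMultOfOrd G q v c
  divide zero    zero    _   c≡0 = ⊥-elim (ℕP.<⇒≢ 0<c (sym c≡0))
  divide zero    (suc k) _   c≡  = o , ord , suc k , s≤s z≤n , c≡
  divide (suc r) k       r<o c≡  = ⊥-elim (below (suc r) (s≤s z≤n) r<o
    (principal-lincomb G principalc principalo 1ℤ (- (+ k)) _ λ u → begin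
      lookup ((+ suc r) · (unit v ⊖ unit q)) u               ≡⟨ lookup-· (+ suc r) (unit v ⊖ unit q) u ⟩
      + suc r * d u                                          ≡⟨ remainder (+ suc r) (+ k) (+ o) (d u) ⟩
      1ℤ * ((+ suc r + + k * + o) * d u) + (- (+ k)) * (+ o * d u)
                                                             ≡⟨ cong₂ (λ s t → 1ℤ * (s * d u) + (- (+ k)) * t) c≡′
                                                                  (sym (lookup-· (+ o) (unit v ⊖ unit q) u)) ⟩
      1ℤ * (+ c * d u) + (- (+ k)) * lookup ((+ o) · (unit v ⊖ unit q)) u
                                                             ≡⟨ cong (λ s → 1ℤ * s + _) (sym (lookup-· (+ c) (unit v ⊖ unit q) u)) ⟩
      1ℤ * lookup ((+ c) · (unit v ⊖ unit q)) u + (- (+ k)) * lookup ((+ o) · (unit v ⊖ unit q)) u ∎))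
    where
    open ≡-Reasoning
    remainder : ∀ r k o x → r * x ≡ 1ℤ * ((r + k * o) * x) + (- k) * (o * x)
    remainder = solve-∀
    c≡′ : + suc r + + k * + o ≡ + c
    c≡′ = sym (trans (cong +_ c≡) (trans (ℤP.pos-+ (suc r) (k ℕ.* o)) (cong (λ z → + suc r + z) (ℤP.pos-* k o))))

euclidean-unique : ∀ l .{{_ : ℕ.NonZero l}} {r r′ k k′} → r ℕ.< l → r′ ℕ.< l →
  r ℕ.+ k ℕ.* l ≡ r′ ℕ.+ k′ ℕ.* l → r ≡ r′ × k ≡ k′
euclidean-unique l {r} {r′} {k} {k′} r<l r′<l e =
  r≡r′ , ℕP.*-cancelʳ-≡ k k′ l (ℕP.+-cancelˡ-≡ r _ _ (trans e (cong (ℕ._+ k′ ℕ.* l) (sym r≡r′))))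
  where
  r≡r′ : r ≡ r′
  r≡r′ = begin
    r                        ≡⟨ sym (ℕD.m<n⇒m%n≡m r<l) ⟩
    r ℕD.% l                 ≡⟨ sym (ℕD.[m+kn]%n≡m%n r k l) ⟩
    (r ℕ.+ k ℕ.* l) ℕD.% l   ≡⟨ cong (ℕD._% l) e ⟩
    (r′ ℕ.+ k′ ℕ.* l) ℕD.% l ≡⟨ ℕD.[m+kn]%n≡m%n r′ k′ l ⟩
    r′ ℕD.% l                ≡⟨ ℕD.m<n⇒m%n≡m r′<l ⟩
    r′                       ∎
    where open ≡-Reasoning

⊖-⊕-cancel : ∀ {n} (E C : Div n) → (E ⊖ C) ⊕ C ≡ E
⊖-⊕-cancel E C = Div-ext λ u →
  trans (lookup-⊕ (E ⊖ C) C u) (trans (cong (_+ lookup C u) (lookup-⊖ E C u)) (cancel (lookup E u) (lookup C u)))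
  where
  cancel : ∀ a c → (a - c) + c ≡ a
  cancel = solve-∀

effective⇒+∣∣ : ∀ {n} (E : Div n) → Effective E → ∀ u → lookup E u ≡ + ∣ lookup E u ∣
effective⇒+∣∣ E eff u = sym (ℤP.0≤i⇒+∣i∣≡i (eff u))

Unique-lookup-injective : ∀ {A : Set} {xs : List A} → Unique xs → ∀ i j → L.lookup xs i ≡ L.lookup xs j → i ≡ j
Unique-lookup-injective (x∉ ∷ u) zero    zero    e = refl
Unique-lookup-injective (x∉ ∷ u) zero    (suc j) e = ⊥-elim (All.lookup x∉ (∈-lookup j) e)
Unique-lookup-injective (x∉ ∷ u) (suc i) zero    e = ⊥-elim (All.lookup x∉ (∈-lookup i) (sym e))
Unique-lookup-injective (x∉ ∷ u) (suc i) (suc j) e = cong suc (Unique-lookup-injective u i j e)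

module StandardPrimary {n} (𝒫 : List (Div n)) (unique : Unique 𝒫) (ℓ : Fin n → ℕ) (ℓ-pos : ∀ v → 0 ℕ.< ℓ v)
  (𝒫-shape : ∀ X → X ∈ 𝒫 → ∃ λ v → X ≡ (+ ℓ v) · unit v)
  (𝒫-full : ∀ v → (+ ℓ v) · unit v ∈ 𝒫) where

  vertexAt : Fin (length 𝒫) → Fin n
  vertexAt i = proj₁ (𝒫-shape (L.lookup 𝒫 i) (∈-lookup i))

  vertexAt-spec : ∀ i → L.lookup 𝒫 i ≡ (+ ℓ (vertexAt i)) · unit (vertexAt i)
  vertexAt-spec i = proj₂ (𝒫-shape (L.lookup 𝒫 i) (∈-lookup i))

  positionOf : Fin n → Fin (length 𝒫)
  positionOf v = Any.index (𝒫-full v)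

  positionOf-spec : ∀ v → L.lookup 𝒫 (positionOf v) ≡ (+ ℓ v) · unit v
  positionOf-spec v = sym (AnyP.lookup-index (𝒫-full v))

  vertexAt-positionOf : ∀ v → vertexAt (positionOf v) ≡ v
  vertexAt-positionOf v = ·unit-injective (ℓ (vertexAt (positionOf v))) (ℓ v) (vertexAt (positionOf v)) v (ℓ-pos _)
    (trans (sym (vertexAt-spec (positionOf v))) (positionOf-spec v))

  positionOf-vertexAt : ∀ i → positionOf (vertexAt i) ≡ i
  positionOf-vertexAt i = Unique-lookup-injective unique _ _ (trans (positionOf-spec (vertexAt i)) (sym (vertexAt-spec i)))

  lookup-comb-standard : ∀ a u → lookup (comb 𝒫 a) u ≡ + (a (positionOf u) ℕ.* ℓ u)
  lookup-comb-standard a u = trans (lookup-comb 𝒫 a u) (trans (sumFin-single _ (positionOf u) off) on)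
    where
    off : ∀ i → i ≢ positionOf u → + a i * lookup (L.lookup 𝒫 i) u ≡ 0ℤ
    off i i≢p = trans (cong (λ X → + a i * lookup X u) (vertexAt-spec i))
                 (trans (cong (+ a i *_) (lookup-·unit-other (+ ℓ (vertexAt i))
                          (λ t≡u → i≢p (trans (sym (positionOf-vertexAt i)) (cong positionOf t≡u)))))
                        (ℤP.*-zeroʳ (+ a i)))
    on : + a (positionOf u) * lookup (L.lookup 𝒫 (positionOf u)) u ≡ + (a (positionOf u) ℕ.* ℓ u)
    on = trans (cong (λ X → + a (positionOf u) * lookup X u) (positionOf-spec u))
          (trans (cong (+ a (positionOf u) *_) (lookup-·unit-same (+ ℓ u) u)) (sym (ℤP.pos-* (a (positionOf u)) (ℓ u))))

  decompose : ∀ E → Effective E → Σ (Fin (length 𝒫) → ℕ) λ a →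
    Effective (E ⊖ comb 𝒫 a) × (∀ u → lookup (E ⊖ comb 𝒫 a) u < + ℓ u)
  decompose E eff = a , (λ u → subst (0ℤ ≤_) (sym (remainder-spec u)) (0≤+ _)) ,
                        (λ u → subst (_< + ℓ u) (sym (remainder-spec u)) (+<+ (ℕD.m%n<n ∣ lookup E u ∣ (ℓ u) {{nonZero u}})))
    where
    nonZero : ∀ v → ℕ.NonZero (ℓ v)
    nonZero v = ℕ.>-nonZero (ℓ-pos v)
    quotient : Fin n → ℕ
    quotient u = ℕD._/_ ∣ lookup E u ∣ (ℓ u) {{nonZero u}}
    remainder : Fin n → ℕ
    remainder u = ℕD._%_ ∣ lookup E u ∣ (ℓ u) {{nonZero u}}
    a : Fin (length 𝒫) → ℕ
    a i = quotient (vertexAt i)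
    remainder-spec : ∀ u → lookup (E ⊖ comb 𝒫 a) u ≡ + remainder u
    remainder-spec u = begin
      lookup (E ⊖ comb 𝒫 a) u                              ≡⟨ lookup-⊖ E (comb 𝒫 a) u ⟩
      lookup E u - lookup (comb 𝒫 a) u                     ≡⟨ cong₂ _-_ (effective⇒+∣∣ E eff u) (lookup-comb-standard a u) ⟩
      + ∣ lookup E u ∣ - + (quotient (vertexAt (positionOf u)) ℕ.* ℓ u)
                                                           ≡⟨ cong (λ z → + ∣ lookup E u ∣ - + (quotient z ℕ.* ℓ u)) (vertexAt-positionOf u) ⟩
      + ∣ lookup E u ∣ - + (quotient u ℕ.* ℓ u)            ≡⟨ cong (λ z → + z - + (quotient u ℕ.* ℓ u))
                                                                (ℕD.m≡m%n+[m/n]*n ∣ lookup E u ∣ (ℓ u) {{nonZero u}}) ⟩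
      + (remainder u ℕ.+ quotient u ℕ.* ℓ u) - + (quotient u ℕ.* ℓ u)
                                                           ≡⟨ m-n≡∸ (ℕP.m≤n+m (quotient u ℕ.* ℓ u) (remainder u)) ⟩
      + (remainder u ℕ.+ quotient u ℕ.* ℓ u ∸ quotient u ℕ.* ℓ u)
                                                           ≡⟨ cong +_ (ℕP.m+n∸n≡m (remainder u) (quotient u ℕ.* ℓ u)) ⟩
      + remainder u                                        ∎
      where open ≡-Reasoning

  decomposition-unique : ∀ {F F′} a a′ → Effective F → Effective F′ →
    (∀ u → lookup F u < + ℓ u) → (∀ u → lookup F′ u < + ℓ u) →
    F ⊕ comb 𝒫 a ≡ F′ ⊕ comb 𝒫 a′ → F ≡ F′ × (∀ i → a i ≡ a′ i)
  decomposition-unique {F} {F′} a a′ eff eff′ F<ℓ F′<ℓ same =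
    Div-ext (λ u → trans (effective⇒+∣∣ F eff u) (trans (cong +_ (proj₁ (atVertex u))) (sym (effective⇒+∣∣ F′ eff′ u)))) ,
    λ i → trans (cong a (sym (positionOf-vertexAt i))) (trans (proj₂ (atVertex (vertexAt i))) (cong a′ (positionOf-vertexAt i)))
    where
    below : ∀ X → Effective X → (∀ u → lookup X u < + ℓ u) → ∀ u → ∣ lookup X u ∣ ℕ.< ℓ u
    below X eff X<ℓ u = ℤP.drop‿+<+ (subst (_< + ℓ u) (effective⇒+∣∣ X eff u) (X<ℓ u))
    entry : ∀ X b u → Effective X → lookup (X ⊕ comb 𝒫 b) u ≡ + (∣ lookup X u ∣ ℕ.+ b (positionOf u) ℕ.* ℓ u)
    entry X b u eff = trans (lookup-⊕ X (comb 𝒫 b) u)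
                       (trans (cong₂ _+_ (effective⇒+∣∣ X eff u) (lookup-comb-standard b u))
                              (sym (ℤP.pos-+ ∣ lookup X u ∣ (b (positionOf u) ℕ.* ℓ u))))
    atVertex : ∀ u → ∣ lookup F u ∣ ≡ ∣ lookup F′ u ∣ × a (positionOf u) ≡ a′ (positionOf u)
    atVertex u = euclidean-unique (ℓ u) {{ℕ.>-nonZero (ℓ-pos u)}} (below F eff F<ℓ u) (below F′ eff′ F′<ℓ u)
      (ℤP.+-injective (trans (sym (entry F a u eff)) (trans (cong (λ X → lookup X u) same) (entry F′ a′ u eff′))))

-- Part (2), "if"

characterized⇒part1 : ∀ {n} (G : Multigraph n) q (𝒫 : List (Div n)) → Unique 𝒫 → (𝒮 : Div n → List (Div n)) →
  Characterized G q 𝒫 𝒮 → Part1 G q 𝒫 𝒮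
characterized⇒part1 {n} G q 𝒫 unique 𝒮 (ℓ , ℓ-multiple , 𝒫-iff , 𝒮-iff) =
  unique , primary∈E , secondary∈E , class-invariant , λ D deg≡0 E inE → existence D deg≡0 E inE , uniqueness D deg≡0 E
  where
  open StandardPrimary 𝒫 unique ℓ (λ v → posMultOfOrd-pos G q v (ℓ-multiple v))
         (λ X → proj₁ (𝒫-iff X)) (λ v → proj₂ (𝒫-iff _) (v , refl))

  primary∈E : ∀ X → X ∈ 𝒫 → InE G q zeroDiv X
  primary∈E X X∈𝒫 with proj₁ (𝒫-iff X) X∈𝒫
  ... | v , refl = inE₀-·unit G q (ℓ v) v (posMultOfOrd⇒principal G q v (ℓ-multiple v))

  secondary∈E : ∀ D → deg D ≡ 0ℤ → ∀ F → F ∈ 𝒮 D → InE G q D F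
  secondary∈E D deg≡0 F F∈𝒮 = proj₁ (proj₁ (𝒮-iff D deg≡0 F) F∈𝒮)

  secondary<ℓ : ∀ D → deg D ≡ 0ℤ → ∀ F → F ∈ 𝒮 D → ∀ v → lookup F v < + ℓ v
  secondary<ℓ D deg≡0 F F∈𝒮 = proj₂ (proj₁ (𝒮-iff D deg≡0 F) F∈𝒮)

  move : ∀ D D′ → deg D ≡ 0ℤ → deg D′ ≡ 0ℤ → D ∼⟨ G ⟩ D′ → ∀ X → X ∈ 𝒮 D → X ∈ 𝒮 D′
  move D D′ deg≡0 deg′≡0 D∼D′ X X∈𝒮 =
    proj₂ (𝒮-iff D′ deg′≡0 X) (inE-∼ G q D∼D′ (secondary∈E D deg≡0 X X∈𝒮) , secondary<ℓ D deg≡0 X X∈𝒮)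

  class-invariant : ∀ D D′ → deg D ≡ 0ℤ → deg D′ ≡ 0ℤ → D ∼⟨ G ⟩ D′ →
    ∀ X → (X ∈ 𝒮 D → X ∈ 𝒮 D′) × (X ∈ 𝒮 D′ → X ∈ 𝒮 D)
  class-invariant D D′ deg≡0 deg′≡0 D∼D′ X =
    move D D′ deg≡0 deg′≡0 D∼D′ X , move D′ D deg′≡0 deg≡0 (∼-sym G D∼D′) X

  existence : ∀ D → deg D ≡ 0ℤ → ∀ E → InE G q D E →
    Σ (Div n) λ F → Σ (Fin (length 𝒫) → ℕ) λ a → F ∈ 𝒮 D × E ≡ F ⊕ comb 𝒫 a
  existence D deg≡0 E inE with decompose E (proj₁ inE)
  ... | a , eff , F<ℓ = E ⊖ comb 𝒫 a , a ,
        proj₂ (𝒮-iff D deg≡0 (E ⊖ comb 𝒫 a)) (inE-⊖ G q inE (inE-comb G q 𝒫 primary∈E a) eff , F<ℓ) ,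
        sym (⊖-⊕-cancel E (comb 𝒫 a))

  uniqueness : ∀ D → deg D ≡ 0ℤ → ∀ E → ∀ F F′ a a′ → F ∈ 𝒮 D → F′ ∈ 𝒮 D →
    E ≡ F ⊕ comb 𝒫 a → E ≡ F′ ⊕ comb 𝒫 a′ → F ≡ F′ × (∀ i → a i ≡ a′ i)
  uniqueness D deg≡0 E F F′ a a′ F∈𝒮 F′∈𝒮 E≡ E≡′ =
    decomposition-unique a a′ (proj₁ (secondary∈E D deg≡0 F F∈𝒮)) (proj₁ (secondary∈E D deg≡0 F′ F′∈𝒮))
      (secondary<ℓ D deg≡0 F F∈𝒮) (secondary<ℓ D deg≡0 F′ F′∈𝒮) (trans (sym E≡) E≡′)

prodℕ : ∀ {n} → (Fin n → ℕ) → ℕ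
prodℕ {zero}  f = 1
prodℕ {suc n} f = f zero ℕ.* prodℕ (λ i → f (suc i))

prodℕ-pos : ∀ {n} (f : Fin n → ℕ) → (∀ i → 0 ℕ.< f i) → 0 ℕ.< prodℕ f
prodℕ-pos {zero}  f pos = s≤s z≤n
prodℕ-pos {suc n} f pos = ℕP.*-mono-< (pos zero) (prodℕ-pos (λ i → f (suc i)) (λ i → pos (suc i)))

factor∣prodℕ : ∀ {n} (f : Fin n → ℕ) i → f i ∣ prodℕ f
factor∣prodℕ {suc n} f zero    = m∣m*n _
factor∣prodℕ {suc n} f (suc i) = ∣n⇒∣m*n (f zero) (factor∣prodℕ (λ i → f (suc i)) i)

-- Part (2), "only if"

entryBound : ∀ {n} → List (Div n) → Fin n → ℕ
entryBound []       v = 0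
entryBound (F ∷ Fs) v = ∣ lookup F v ∣ ℕ.+ entryBound Fs v

∣entry∣≤entryBound : ∀ {n} {F : Div n} {Fs} → F ∈ Fs → ∀ v → ∣ lookup F v ∣ ℕ.≤ entryBound Fs v
∣entry∣≤entryBound (here refl) v = ℕP.m≤m+n _ _
∣entry∣≤entryBound {Fs = _ ∷ Fs} (there F∈Fs) v = ℕP.≤-trans (∣entry∣≤entryBound F∈Fs v) (ℕP.m≤n+m _ _)

single : ∀ {m} → Fin m → ℕ → Fin m → ℕ
single j k i = if does (i ≟ j) then k else 0

single-same : ∀ {m} (j : Fin m) k → single j k j ≡ k
single-same j k with j ≟ j
... | yes _   = refl
... | no j≢j = ⊥-elim (j≢j refl)

single-other : ∀ {m} {i j : Fin m} k → i ≢ j → single j k i ≡ 0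
single-other {i = i} {j} k i≢j with i ≟ j
... | yes i≡j = ⊥-elim (i≢j i≡j)
... | no _    = refl

lookup-comb-single : ∀ {n} (𝒫 : List (Div n)) j k u → lookup (comb 𝒫 (single j k)) u ≡ + k * lookup (L.lookup 𝒫 j) u
lookup-comb-single 𝒫 j k u =
  trans (lookup-comb 𝒫 (single j k) u)
   (trans (sumFin-single _ j (λ i i≢j → trans (cong (λ z → + z * lookup (L.lookup 𝒫 i) u) (single-other k i≢j))
                                              (ℤP.*-zeroˡ (lookup (L.lookup 𝒫 i) u))))
          (cong (λ z → + z * lookup (L.lookup 𝒫 j) u) (single-same j k)))

lookup-comb-+ : ∀ {n} (𝒫 : List (Div n)) a a′ u →
  lookup (comb 𝒫 (λ i → a i ℕ.+ a′ i)) u ≡ lookup (comb 𝒫 a) u + lookup (comb 𝒫 a′) u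
lookup-comb-+ 𝒫 a a′ u = begin
  lookup (comb 𝒫 (λ i → a i ℕ.+ a′ i)) u                       ≡⟨ lookup-comb 𝒫 _ u ⟩
  sumFin (λ i → + (a i ℕ.+ a′ i) * P i)                       ≡⟨ sumFin-cong (λ i → trans (cong (_* P i) (ℤP.pos-+ (a i) (a′ i)))
                                                                                         (ℤP.*-distribʳ-+ (P i) (+ a i) (+ a′ i))) ⟩
  sumFin (λ i → + a i * P i + + a′ i * P i)                   ≡⟨ sumFin-+ (λ i → + a i * P i) (λ i → + a′ i * P i) ⟩
  sumFin (λ i → + a i * P i) + sumFin (λ i → + a′ i * P i)    ≡⟨ sym (cong₂ _+_ (lookup-comb 𝒫 a u) (lookup-comb 𝒫 a′ u)) ⟩
  lookup (comb 𝒫 a) u + lookup (comb 𝒫 a′) u                  ∎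
  where
  open ≡-Reasoning
  P : Fin (length 𝒫) → ℤ
  P i = lookup (L.lookup 𝒫 i) u

lookup-comb-0 : ∀ {n} (𝒫 : List (Div n)) a → (∀ i → a i ≡ 0) → ∀ u → lookup (comb 𝒫 a) u ≡ 0ℤ
lookup-comb-0 𝒫 a a≡0 u =
  trans (lookup-comb 𝒫 a u)
   (trans (sumFin-cong (λ i → trans (cong (λ z → + z * lookup (L.lookup 𝒫 i) u) (a≡0 i)) (ℤP.*-zeroˡ (lookup (L.lookup 𝒫 i) u))))
          (sumFin-0 {length 𝒫}))

⊕-comb-zero : ∀ {n} (𝒫 : List (Div n)) E → E ⊕ comb 𝒫 (λ _ → 0) ≡ E
⊕-comb-zero 𝒫 E = Div-ext λ u → trans (lookup-⊕ E _ u)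
  (trans (cong (λ z → lookup E u + z) (lookup-comb-0 𝒫 (λ _ → 0) (λ _ → refl) u)) (ℤP.+-identityʳ _))

module Part1Consequences {n} (G : Multigraph n) (conn : Connected G) (q : Fin n)
  (𝒫 : List (Div n)) (𝒮 : Div n → List (Div n)) (part1 : Part1 G q 𝒫 𝒮) where

  primary : Fin (length 𝒫) → Div n
  primary = L.lookup 𝒫

  primary∈E : ∀ X → X ∈ 𝒫 → InE G q zeroDiv X
  primary∈E = proj₁ (proj₂ part1)

  secondary∈E : ∀ D → deg D ≡ 0ℤ → ∀ F → F ∈ 𝒮 D → InE G q D F
  secondary∈E = proj₁ (proj₂ (proj₂ part1))

  decomposition-exists : ∀ D → deg D ≡ 0ℤ → ∀ E → InE G q D E →
    Σ (Div n) λ F → Σ (Fin (length 𝒫) → ℕ) λ a → F ∈ 𝒮 D × E ≡ F ⊕ comb 𝒫 a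
  decomposition-exists D deg≡0 E inE = proj₁ (proj₂ (proj₂ (proj₂ (proj₂ part1))) D deg≡0 E inE)

  decomposition-unique : ∀ D → deg D ≡ 0ℤ → ∀ E → InE G q D E → ∀ F F′ a a′ → F ∈ 𝒮 D → F′ ∈ 𝒮 D →
    E ≡ F ⊕ comb 𝒫 a → E ≡ F′ ⊕ comb 𝒫 a′ → F ≡ F′ × (∀ i → a i ≡ a′ i)
  decomposition-unique D deg≡0 E inE = proj₂ (proj₂ (proj₂ (proj₂ (proj₂ part1))) D deg≡0 E inE)

  primary-effective : ∀ i → Effective (primary i)
  primary-effective i = proj₁ (primary∈E (primary i) (∈-lookup i))

  comb-effective : ∀ a → Effective (comb 𝒫 a)
  comb-effective a u = subst (0ℤ ≤_) (sym (lookup-comb 𝒫 a u)) (sumFin-nonNeg (λ i → 0≤+* (a i) (primary-effective i u)))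

  zeroDiv∈𝒮₀ : zeroDiv ∈ 𝒮 zeroDiv
  zeroDiv∈𝒮₀ with decomposition-exists zeroDiv (deg-zeroDiv {n}) zeroDiv (inE-zeroDiv G q)
  ... | F , a , F∈𝒮 , 0≡F+C = subst (_∈ 𝒮 zeroDiv) (Div-ext F≡0) F∈𝒮
    where
    F≡0 : ∀ u → lookup F u ≡ lookup zeroDiv u
    F≡0 u = trans (nonNeg-sum≡0ˡ (sym (trans (sym (lookup-zeroDiv u)) (trans (cong (λ X → lookup X u) 0≡F+C) (lookup-⊕ F (comb 𝒫 a) u))))
                                 (proj₁ (secondary∈E zeroDiv (deg-zeroDiv {n}) F F∈𝒮) u) (comb-effective a u))
                  (sym (lookup-zeroDiv u))

  zeroDiv⊕ : ∀ (X : Div n) → zeroDiv ⊕ X ≡ X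
  zeroDiv⊕ X = Div-ext λ u → trans (lookup-⊕ zeroDiv X u) (trans (cong (_+ lookup X u) (lookup-zeroDiv u)) (ℤP.+-identityˡ _))

  comb-injective : ∀ a a′ → (∀ u → lookup (comb 𝒫 a) u ≡ lookup (comb 𝒫 a′) u) → ∀ i → a i ≡ a′ i
  comb-injective a a′ same = proj₂ (decomposition-unique zeroDiv (deg-zeroDiv {n}) (comb 𝒫 a)
    (inE-comb G q 𝒫 primary∈E a) zeroDiv zeroDiv a a′ zeroDiv∈𝒮₀ zeroDiv∈𝒮₀
    (sym (zeroDiv⊕ (comb 𝒫 a))) (trans (Div-ext same) (sym (zeroDiv⊕ (comb 𝒫 a′)))))

  ConcentratedPrimary : Fin n → Set
  ConcentratedPrimary v = ∃ λ i → 0 ℕ.< ∣ lookup (primary i) v ∣ × primary i ≡ (+ ∣ lookup (primary i) v ∣) · unit v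

  concentrated-summand : ∀ a v → (∀ w → v ≢ w → lookup (comb 𝒫 a) w ≡ 0ℤ) → 0ℤ < lookup (comb 𝒫 a) v →
    ConcentratedPrimary v
  concentrated-summand a v off pos with sumFin-pos⇒term-pos (λ i → + a i * lookup (primary i) v) (subst (0ℤ <_) (lookup-comb 𝒫 a v) pos)
  ... | i , 0<term = i , 0<c , Div-ext entry
    where
    c = ∣ lookup (primary i) v ∣
    c≡ : lookup (primary i) v ≡ + c
    c≡ = effective⇒+∣∣ (primary i) (primary-effective i) v
    0<c : 0 ℕ.< c
    0<c = ℕP.n≢0⇒n>0 λ c≡0 → ℤP.<-irrefl refl
            (subst (0ℤ <_) (trans (cong (+ a i *_) (trans c≡ (cong +_ c≡0))) (ℤP.*-zeroʳ (+ a i))) 0<term)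
    a≢0 : + a i ≢ 0ℤ
    a≢0 a≡0 = ℤP.<-irrefl refl (subst (0ℤ <_) (trans (cong (_* lookup (primary i) v) a≡0) (ℤP.*-zeroˡ (lookup (primary i) v))) 0<term)
    entry : ∀ w → lookup (primary i) w ≡ lookup ((+ c) · unit v) w
    entry w with v ≟ w
    ... | yes refl = trans c≡ (sym (lookup-·unit-same (+ c) v))
    ... | no  v≢w  with ℤP.i*j≡0⇒i≡0∨j≡0 (+ a i)
                          (nonNeg-sumFin≤0⇒0 (λ j → + a j * lookup (primary j) w) (λ j → 0≤+* (a j) (primary-effective j w))
                             (ℤP.≤-reflexive (trans (sym (lookup-comb 𝒫 a w)) (off w v≢w))) i)
    ...   | inj₁ a≡0 = ⊥-elim (a≢0 a≡0)
    ...   | inj₂ P≡0 = trans P≡0 (sym (lookup-·unit-other (+ c) v≢w))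

  -- The secondary part of c v is too small at v once c exceeds every entry of 𝒮_[0] there.
  large-multiple-concentrated : ∀ v c → entryBound (𝒮 zeroDiv) v ℕ.< c → ∀ F a → F ∈ 𝒮 zeroDiv →
    (+ c) · unit v ≡ F ⊕ comb 𝒫 a → ConcentratedPrimary v
  large-multiple-concentrated v c B<c F a F∈𝒮 cv≡ = concentrated-summand a v off pos
    where
    entry : ∀ u → lookup ((+ c) · unit v) u ≡ lookup F u + lookup (comb 𝒫 a) u
    entry u = trans (cong (λ X → lookup X u) cv≡) (lookup-⊕ F (comb 𝒫 a) u)
    effF : Effective F
    effF = proj₁ (secondary∈E zeroDiv (deg-zeroDiv {n}) F F∈𝒮)
    off : ∀ w → v ≢ w → lookup (comb 𝒫 a) w ≡ 0ℤ
    off w v≢w = nonNeg-sum≡0ˡ (trans (ℤP.+-comm (lookup (comb 𝒫 a) w) (lookup F w))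
                                (trans (sym (entry w)) (lookup-·unit-other (+ c) v≢w)))
                  (comb-effective a w) (effF w)
    pos : 0ℤ < lookup (comb 𝒫 a) v
    pos = ℤP.≰⇒> λ C≤0 → ℤP.<⇒≱ (+<+ B<c) (begin
      + c                                      ≡⟨ sym (lookup-·unit-same (+ c) v) ⟩
      lookup ((+ c) · unit v) v                ≡⟨ entry v ⟩
      lookup F v + lookup (comb 𝒫 a) v         ≤⟨ ℤP.+-monoʳ-≤ (lookup F v) C≤0 ⟩
      lookup F v + 0ℤ                          ≡⟨ ℤP.+-identityʳ (lookup F v) ⟩
      lookup F v                               ≡⟨ effective⇒+∣∣ F effF v ⟩
      + ∣ lookup F v ∣                         ≤⟨ +≤+ (∣entry∣≤entryBound F∈𝒮 v) ⟩
      + entryBound (𝒮 zeroDiv) v               ∎)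
      where open ℤP.≤-Reasoning

  opaque
    primaryAt : ∀ v → Σ (Fin (length 𝒫)) λ i → Σ ℕ λ c → primary i ≡ (+ c) · unit v × PosMultOfOrd G q v c
    primaryAt v = fromDecomposition (decomposition-exists zeroDiv (deg-zeroDiv {n}) Kov Kov∈E)
      where
      order : Σ ℕ (IsOrd G q v)
      order = ChipFiring.order-exists G conn q v
      o : ℕ
      o = proj₁ order
      K : ℕ
      K = suc (entryBound (𝒮 zeroDiv) v)
      Kov : Div n
      Kov = (+ (K ℕ.* o)) · unit v
      Kov∈E : InE G q zeroDiv Kov
      Kov∈E = inE₀-·unit G q (K ℕ.* o) v (posMultOfOrd⇒principal G q v (o , proj₂ order , K , s≤s z≤n , refl))
      fromConcentrated : ConcentratedPrimary v →
        Σ (Fin (length 𝒫)) λ i → Σ ℕ λ c → primary i ≡ (+ c) · unit v × PosMultOfOrd G q v c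
      fromConcentrated (i , 0<c , Pi≡) = i , ∣ lookup (primary i) v ∣ , Pi≡ ,
        principal⇒posMultOfOrd G q v (proj₂ order) 0<c
          (inE₀-·unit⁻¹ G q ∣ lookup (primary i) v ∣ v (subst (InE G q zeroDiv) Pi≡ (primary∈E (primary i) (∈-lookup i))))
      fromDecomposition : (Σ (Div n) λ F → Σ (Fin (length 𝒫) → ℕ) λ a → F ∈ 𝒮 zeroDiv × Kov ≡ F ⊕ comb 𝒫 a) →
        Σ (Fin (length 𝒫)) λ i → Σ ℕ λ c → primary i ≡ (+ c) · unit v × PosMultOfOrd G q v c
      fromDecomposition (F , a , F∈𝒮 , Kov≡) = fromConcentrated (large-multiple-concentrated v (K ℕ.* o)
        (ℕP.<-≤-trans (ℕP.n<1+n (entryBound (𝒮 zeroDiv) v)) (ℕP.m≤m*n K o {{ℕ.>-nonZero (proj₁ (proj₂ order))}})) F a F∈𝒮 Kov≡)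

  positionAt : Fin n → Fin (length 𝒫)
  positionAt v = proj₁ (primaryAt v)

  ℓ : Fin n → ℕ
  ℓ v = proj₁ (proj₂ (primaryAt v))

  positionAt-spec : ∀ v → primary (positionAt v) ≡ (+ ℓ v) · unit v
  positionAt-spec v = proj₁ (proj₂ (proj₂ (primaryAt v)))

  ℓ-multiple : ∀ v → PosMultOfOrd G q v (ℓ v)
  ℓ-multiple v = proj₂ (proj₂ (proj₂ (primaryAt v)))

  ℓ-pos : ∀ v → 0 ℕ.< ℓ v
  ℓ-pos v = posMultOfOrd-pos G q v (ℓ-multiple v)

  positionAt-injective : ∀ v w → positionAt v ≡ positionAt w → v ≡ w
  positionAt-injective v w same =
    ·unit-injective (ℓ v) (ℓ w) v w (ℓ-pos v) (trans (sym (positionAt-spec v)) (trans (cong primary same) (positionAt-spec w)))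

  preimage? : ∀ i → Dec (∃ λ v → positionAt v ≡ i)
  preimage? i = FP.any? (λ v → positionAt v ≟ i)

  spread : (Fin n → ℕ) → Fin (length 𝒫) → ℕ
  spread g i with preimage? i
  ... | yes (v , _) = g v
  ... | no  _       = 0

  spread-at : ∀ g v → spread g (positionAt v) ≡ g v
  spread-at g v with preimage? (positionAt v)
  ... | yes (w , same) = cong g (positionAt-injective w v same)
  ... | no  none       = ⊥-elim (none (v , refl))

  lookup-comb-spread : ∀ g u → lookup (comb 𝒫 (spread g)) u ≡ + (g u ℕ.* ℓ u)
  lookup-comb-spread g u =
    trans (lookup-comb 𝒫 (spread g) u) (trans (sumFin-single _ (positionAt u) off) on)
    where
    off : ∀ i → i ≢ positionAt u → + spread g i * lookup (primary i) u ≡ 0ℤ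
    off i i≢p with preimage? i
    ... | no _ = ℤP.*-zeroˡ (lookup (primary i) u)
    ... | yes (v , refl) = trans (cong (λ X → + g v * lookup X u) (positionAt-spec v))
                            (trans (cong (+ g v *_) (lookup-·unit-other (+ ℓ v) (λ v≡u → i≢p (cong positionAt v≡u))))
                                   (ℤP.*-zeroʳ (+ g v)))
    on : + spread g (positionAt u) * lookup (primary (positionAt u)) u ≡ + (g u ℕ.* ℓ u)
    on = trans (cong₂ (λ s X → + s * lookup X u) (spread-at g u) (positionAt-spec u))
          (trans (cong (+ g u *_) (lookup-·unit-same (+ ℓ u) u)) (sym (ℤP.pos-* (g u) (ℓ u))))

  -- ℓ_u divides M for every u, so M P_j is a combination of the ℓ_u u; by uniqueness its coefficient
  -- vector is M at j, and that forces j to be one of the positions ℓ_u u.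
  positionAt-surjective : ∀ j → ∃ λ v → positionAt v ≡ j
  positionAt-surjective j with preimage? j
  ... | yes found = found
  ... | no  none  = ⊥-elim (ℕP.<⇒≢ (prodℕ-pos ℓ ℓ-pos) (sym (begin
    prodℕ ℓ               ≡⟨ sym (single-same j (prodℕ ℓ)) ⟩
    single j (prodℕ ℓ) j  ≡⟨ comb-injective (single j (prodℕ ℓ)) (spread g) same j ⟩
    spread g j            ≡⟨ spread-outside ⟩
    0                     ∎)))
    where
    open ≡-Reasoning
    M = prodℕ ℓ
    cofactor : Fin n → ℕ
    cofactor u = _∣_.quotient (factor∣prodℕ ℓ u)
    p : Fin n → ℕ
    p u = ∣ lookup (primary j) u ∣
    g : Fin n → ℕ
    g u = cofactor u ℕ.* p u
    spread-outside : spread g j ≡ 0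
    spread-outside with preimage? j
    ... | yes found = ⊥-elim (none found)
    ... | no  _     = refl
    same : ∀ u → lookup (comb 𝒫 (single j M)) u ≡ lookup (comb 𝒫 (spread g)) u
    same u = begin
      lookup (comb 𝒫 (single j M)) u      ≡⟨ lookup-comb-single 𝒫 j M u ⟩
      + M * lookup (primary j) u          ≡⟨ cong (+ M *_) (effective⇒+∣∣ (primary j) (primary-effective j) u) ⟩
      + M * + p u                         ≡⟨ sym (ℤP.pos-* M (p u)) ⟩
      + (M ℕ.* p u)                       ≡⟨ cong (λ m → + (m ℕ.* p u)) (_∣_.equality (factor∣prodℕ ℓ u)) ⟩
      + (cofactor u ℕ.* ℓ u ℕ.* p u)      ≡⟨ cong +_ (rearrange (cofactor u) (ℓ u) (p u)) ⟩
      + (g u ℕ.* ℓ u)                     ≡⟨ sym (lookup-comb-spread g u) ⟩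
      lookup (comb 𝒫 (spread g)) u        ∎
      where
      rearrange : ∀ a b c → a ℕ.* b ℕ.* c ≡ a ℕ.* c ℕ.* b
      rearrange a b c = trans (ℕP.*-assoc a b c) (trans (cong (a ℕ.*_) (ℕP.*-comm b c)) (sym (ℕP.*-assoc a c b)))

  𝒫-shape : ∀ X → X ∈ 𝒫 → ∃ λ v → X ≡ (+ ℓ v) · unit v
  𝒫-shape X X∈𝒫 with positionAt-surjective (Any.index X∈𝒫)
  ... | v , v↦X = v , trans (AnyP.lookup-index X∈𝒫) (trans (cong primary (sym v↦X)) (positionAt-spec v))

  𝒫-full : ∀ v → (+ ℓ v) · unit v ∈ 𝒫
  𝒫-full v = subst (_∈ 𝒫) (positionAt-spec v) (∈-lookup (positionAt v))

  open StandardPrimary 𝒫 (proj₁ part1) ℓ ℓ-pos 𝒫-shape 𝒫-full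
    using (decompose) renaming (decomposition-unique to standard-decomposition-unique)

  secondary<ℓ : ∀ D → deg D ≡ 0ℤ → ∀ E → E ∈ 𝒮 D → ∀ v → lookup E v < + ℓ v
  secondary<ℓ D deg≡0 E E∈𝒮 with secondary∈E D deg≡0 E E∈𝒮
  ... | inE with decompose E (proj₁ inE)
  ...   | a , effR , R<ℓ with decomposition-exists D deg≡0 (E ⊖ comb 𝒫 a) (inE-⊖ G q inE (inE-comb G q 𝒫 primary∈E a) effR)
  ...     | F , a′ , F∈𝒮 , R≡ = λ v → subst (_< + ℓ v) (R≡E v) (R<ℓ v)
    where
    E≡F+C : E ≡ F ⊕ comb 𝒫 (λ i → a′ i ℕ.+ a i)
    E≡F+C = Div-ext λ u → begin
      lookup E u                                           ≡⟨ cong (λ X → lookup X u) (sym (⊖-⊕-cancel E (comb 𝒫 a))) ⟩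
      lookup ((E ⊖ comb 𝒫 a) ⊕ comb 𝒫 a) u                 ≡⟨ lookup-⊕ (E ⊖ comb 𝒫 a) (comb 𝒫 a) u ⟩
      lookup (E ⊖ comb 𝒫 a) u + lookup (comb 𝒫 a) u        ≡⟨ cong (λ X → lookup X u + lookup (comb 𝒫 a) u) R≡ ⟩
      lookup (F ⊕ comb 𝒫 a′) u + lookup (comb 𝒫 a) u       ≡⟨ cong (_+ lookup (comb 𝒫 a) u) (lookup-⊕ F (comb 𝒫 a′) u) ⟩
      lookup F u + lookup (comb 𝒫 a′) u + lookup (comb 𝒫 a) u
                                                           ≡⟨ ℤP.+-assoc (lookup F u) _ _ ⟩
      lookup F u + (lookup (comb 𝒫 a′) u + lookup (comb 𝒫 a) u)
                                                           ≡⟨ cong (λ z → lookup F u + z) (sym (lookup-comb-+ 𝒫 a′ a u)) ⟩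
      lookup F u + lookup (comb 𝒫 (λ i → a′ i ℕ.+ a i)) u  ≡⟨ sym (lookup-⊕ F _ u) ⟩
      lookup (F ⊕ comb 𝒫 (λ i → a′ i ℕ.+ a i)) u           ∎
      where open ≡-Reasoning
    a≡0 : ∀ i → a i ≡ 0
    a≡0 i = ℕP.m+n≡0⇒n≡0 (a′ i) (proj₂ (decomposition-unique D deg≡0 E inE F E _ (λ _ → 0) F∈𝒮 E∈𝒮 E≡F+C (sym (⊕-comb-zero 𝒫 E))) i)
    R≡E : ∀ u → lookup (E ⊖ comb 𝒫 a) u ≡ lookup E u
    R≡E u = trans (lookup-⊖ E (comb 𝒫 a) u)
             (trans (cong (λ z → lookup E u - z) (lookup-comb-0 𝒫 a a≡0 u)) (ℤP.+-identityʳ _))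

  below-ℓ⇒secondary : ∀ D → deg D ≡ 0ℤ → ∀ E → InE G q D E × (∀ v → lookup E v < + ℓ v) → E ∈ 𝒮 D
  below-ℓ⇒secondary D deg≡0 E (inE , E<ℓ) with decomposition-exists D deg≡0 E inE
  ... | F , a , F∈𝒮 , E≡ = subst (_∈ 𝒮 D) F≡E F∈𝒮
    where
    F≡E : F ≡ E
    F≡E = proj₁ (standard-decomposition-unique a (λ _ → 0) (proj₁ (secondary∈E D deg≡0 F F∈𝒮)) (proj₁ inE)
                   (secondary<ℓ D deg≡0 F F∈𝒮) E<ℓ (trans (sym E≡) (sym (⊕-comb-zero 𝒫 E))))

  characterized : Characterized G q 𝒫 𝒮
  characterized = ℓ , ℓ-multiple ,
    (λ X → 𝒫-shape X , λ { (v , refl) → 𝒫-full v }) ,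
    λ D deg≡0 E → (λ E∈𝒮 → secondary∈E D deg≡0 E E∈𝒮 , secondary<ℓ D deg≡0 E E∈𝒮) , below-ℓ⇒secondary D deg≡0 E

-- Part (1): the primaries ord_q(v) v and the secondaries below them

inE? : ∀ {n} (G : Multigraph n) → Connected G → (q : Fin n) → ∀ D E → Dec (InE G q D E)
inE? G conn q D E = FP.all? (λ v → 0ℤ ℤ.≤? lookup E v) ×-dec principal? G conn q (reduced q E ⊖ D)

module Minimal {n} (G : Multigraph n) (conn : Connected G) (q : Fin n) where

  ord : Fin n → ℕ
  ord v = proj₁ (ChipFiring.order-exists G conn q v)

  ord-isOrd : ∀ v → IsOrd G q v (ord v)
  ord-isOrd v = proj₂ (ChipFiring.order-exists G conn q v)

  𝒫₀ : List (Div n)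
  𝒫₀ = L.tabulate (λ v → (+ ord v) · unit v)

  𝒫₀-unique : Unique 𝒫₀
  𝒫₀-unique = UniqueP.tabulate⁺ (λ {v} {w} → ·unit-injective (ord v) (ord w) v w (proj₁ (ord-isOrd v)))

  Secondary : Div n → Div n → Set
  Secondary D E = InE G q D E × (∀ v → lookup E v < + ord v)

  secondary? : ∀ D E → Dec (Secondary D E)
  secondary? D E = inE? G conn q D E ×-dec FP.all? (λ v → lookup E v ℤ.<? + ord v)

  candidates : List (Div n)
  candidates = vecsOver (λ v → L.map +_ (upTo (ord v)))

  𝒮₀ : Div n → List (Div n)
  𝒮₀ D = L.filter (secondary? D) candidates

  characterized₀ : Characterized G q 𝒫₀ 𝒮₀
  characterized₀ = ord , (λ v → ord v , ord-isOrd v , 1 , s≤s z≤n , sym (ℕP.*-identityˡ (ord v))) ,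
    (λ X → ∈-tabulate⁻ , λ { (v , refl) → ∈-tabulate⁺ v }) ,
    λ D deg≡0 E → proj₂ ∘ ∈-filter⁻ (secondary? D) {xs = candidates} ,
                  λ sec → ∈-filter⁺ (secondary? D) (∈-vecsOver _ E (λ v → candidate (proj₁ (proj₁ sec) v) (proj₂ sec v))) sec
    where
    candidate : ∀ {x : ℤ} {v} → 0ℤ ≤ x → x < + ord v → x ∈ L.map +_ (upTo (ord v))
    candidate {+ k} _ (+<+ k<o) = ∈-map⁺ +_ (∈-upTo⁺ k<o)

theorem3p1 : ∀ {n} (G : Multigraph n) → Connected G → (q : Fin n) →
    (Σ (List (Div n)) λ 𝒫 → Σ (Div n → List (Div n)) λ 𝒮 → Part1 G q 𝒫 𝒮)
    × (∀ (𝒫 : List (Div n)) → Unique 𝒫 → (𝒮 : Div n → List (Div n)) →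
         (Part1 G q 𝒫 𝒮 → Characterized G q 𝒫 𝒮)
         × (Characterized G q 𝒫 𝒮 → Part1 G q 𝒫 𝒮))
theorem3p1 G conn q =
  (𝒫₀ , 𝒮₀ , characterized⇒part1 G q 𝒫₀ 𝒫₀-unique 𝒮₀ characterized₀) ,
  λ 𝒫 unique 𝒮 → Part1Consequences.characterized G conn q 𝒫 𝒮 , characterized⇒part1 G q 𝒫 unique 𝒮
  where open Minimal G conn q
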